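{- For every integer $d\ge 1$, there exists a planar graph containing a distance-$d$ half graph of order $2^{\left\lceil \frac{d}{2}\right\rceil}$; that is, the maximum order of a distance-$d$ half graph in the class of planar graphs is at least $2^{\lceil d/2\rceil}$.
   Context: All graphs are finite, undirected and simple; $\mathrm{dist}$ is the shortest-path distance. For integers $d,\ell\ge1$, $2\ell$ pairwise distinct vertices $a_1,\dots,a_\ell,b_1,\dots,b_\ell$ of a graph form a distance-$d$ half graph of order $\ell$ if for all $i,j\in[1,\ell]$ we have $\mathrm{dist}(b_i,a_j)\le d$ if and only if $i<j$. -}

module Defs where

open import Data.Nat as ℕ using (ℕ; zero; suc; _^_; ⌈_/2⌉)
open import Data.Fin using (Fin; toℕ)
open import Data.Bool using (Bool; true; false)
open import Data.List using (List; []; _∷_; _++_)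
open import Data.Product using (Σ; ∃; ∃-syntax; _×_; _,_)
open import Data.Sum using (_⊎_)
open import Data.Empty using (⊥)
open import Data.Rational using (ℚ; 0ℚ; 1ℚ; _+_; _*_; _-_)
import Data.Rational as ℚ
open import Relation.Nullary using (¬_)
open import Relation.Binary.PropositionalEquality using (_≡_; _≢_)
open import Function.Bundles using (_⇔_)

record Graph : Set where
  field
    n      : ℕ
    adj    : Fin n → Fin n → Bool
    sym    : ∀ u v → adj u v ≡ adj v u
    irrefl : ∀ u → adj u u ≡ false

module _ (G : Graph) where
  open Graph G

  Adj : Fin n → Fin n → Set
  Adj u v = adj u v ≡ true

  data Walk : Fin n → Fin n → ℕ → Set where
    [] : ∀ {u} → Walk u u 0
    _∷_ : ∀ {u w v k} → Adj u w → Walk w v k → Walk u v (suc k)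

  -- dist(u , v) ≤ d  (distance is the length of a shortest walk; ∞ if none)
  DistLE : ℕ → Fin n → Fin n → Set
  DistLE d u v = ∃[ k ] (k ℕ.≤ d × Walk u v k)

  -- a , b : Fin ℓ → V list a_1..a_ℓ , b_1..b_ℓ (indexed from 0);
  -- all 2ℓ vertices pairwise distinct, and dist(b_i,a_j) ≤ d ⇔ i < j
  IsDistHalfGraph : ℕ → (ℓ : ℕ) → (Fin ℓ → Fin n) → (Fin ℓ → Fin n) → Set
  IsDistHalfGraph d ℓ a b =
    (∀ i j → a i ≡ a j → i ≡ j) ×
    (∀ i j → b i ≡ b j → i ≡ j) ×
    (∀ i j → a i ≢ b j) ×
    (∀ i j → DistLE d (b i) (a j) ⇔ (toℕ i ℕ.< toℕ j))

  HasDistHalfGraph : ℕ → ℕ → Set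
  HasDistHalfGraph d ℓ = Σ (Fin ℓ → Fin n) λ a → Σ (Fin ℓ → Fin n) λ b →
    IsDistHalfGraph d ℓ a b

-- Planarity: embedding in the plane with polygonal arcs (rational
-- coordinates).

Point : Set
Point = ℚ × ℚ

OnSeg : Point → Point → Point → Set
OnSeg (ax , ay) (bx , by) (px , py) =
  ∃[ t ] (0ℚ ℚ.≤ t × t ℚ.≤ 1ℚ ×
          px ≡ ax + t * (bx - ax) × py ≡ ay + t * (by - ay))

OnPath : List Point → Point → Set
OnPath [] p = ⊥
OnPath (x ∷ []) p = ⊥
OnPath (x ∷ y ∷ rest) p = OnSeg x y p ⊎ OnPath (y ∷ rest) p

module _ (G : Graph) where
  open Graph G

  -- an edge {u,v} is represented once, by u < v
  IsEdge : Fin n → Fin n → Set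
  IsEdge u v = (toℕ u ℕ.< toℕ v) × Adj G u v

  record PlaneEmbedding : Set where
    field
      pos   : Fin n → Point
      bends : Fin n → Fin n → List Point
    curve : Fin n → Fin n → List Point
    curve u v = pos u ∷ (bends u v ++ (pos v ∷ []))
    field
      pos-injective : ∀ u v → pos u ≡ pos v → u ≡ v
      avoids-vertices : ∀ u v → IsEdge u v → ∀ w → w ≢ u → w ≢ v →
        ¬ OnPath (curve u v) (pos w)
      internally-disjoint : ∀ u v u′ v′ → IsEdge u v → IsEdge u′ v′ →
        (u ≢ u′ ⊎ v ≢ v′) → ∀ p → OnPath (curve u v) p → OnPath (curve u′ v′) p →
        ∃[ w ] ((w ≡ u ⊎ w ≡ v) × (w ≡ u′ ⊎ w ≡ v′) × p ≡ pos w)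

  Planar : Set
  Planar = PlaneEmbedding

-- G_0 consists of two isolated vertices, its root a_0 and its sink b_0. G_(k+1) consists
-- of two copies of G_k, a new root joined to both old roots, a new sink joined to both old
-- sinks, and a bridge path of length d - 2k from the sink of the first copy to the root of
-- the second. For h = ⌈d/2⌉ the graph G_h has 2^h leaf pairs a_j b_j.
-- If i < j, the pairs i and j are separated at some level k + 1, and climbing k edges from
-- b_i to a sink, crossing the bridge and descending k edges to a_j takes d steps.
-- Conversely, every vertex carries a level (d at each a_j, 0 at each b_j) that changes by
-- exactly one along every edge, and a rank that never decreases as the level increases,
-- with rank b_i ≤ rank a_j only if i < j. A walk of length at most d from b_i to a_j must
-- raise the level at every step, so i < j.
-- G_h is planar: put the vertices in order on a line; the new root edge to the second copy
-- and the new sink edge from the first copy are drawn as arcs above and below the line,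
-- which are nested or disjoint, and every other edge joins consecutive vertices.

module Submission where

open import Defs

module ArcDiagrams where

  open import Data.Nat as ℕ using (ℕ; zero; suc)
  import Data.Nat.Properties as ℕₚ
  open import Data.Fin using (Fin; toℕ)
  open import Data.Fin.Properties using (toℕ-injective)
  open import Data.Rational
    using (ℚ; 0ℚ; 1ℚ; ½; _+_; _*_; _-_; -_; _≤_; _<_; NonZero; NonNegative; 1/_; ≢-nonZero; nonNegative)
  open import Data.Rational.Properties
  open import Data.Rational.Solver using (module +-*-Solver)
  open import Data.Product using (∃-syntax; _×_; _,_; proj₁; proj₂)
  open import Data.Sum as Sum using (_⊎_; inj₁; inj₂)
  open import Data.Empty using (⊥-elim)
  open import Data.Unit using (⊤)
  open import Data.List using (List; []; _∷_; _++_; map)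
  open import Relation.Nullary using (¬_)
  open import Relation.Binary.PropositionalEquality
  open import Relation.Binary.Definitions using (tri<; tri≈; tri>)

  open +-*-Solver using (solve; _:+_; _:*_; _:-_; :-_; _:=_; con)

  p*q≡0⇒p≡0 : ∀ p q → q ≢ 0ℚ → p * q ≡ 0ℚ → p ≡ 0ℚ
  p*q≡0⇒p≡0 p q q≢0 pq≡0 = begin
      p                ≡⟨ sym (*-identityʳ p) ⟩
      p * 1ℚ           ≡⟨ cong (p *_) (sym (*-inverseʳ q)) ⟩
      p * (q * 1/ q)   ≡⟨ sym (*-assoc p q (1/ q)) ⟩
      (p * q) * 1/ q   ≡⟨ cong (_* 1/ q) pq≡0 ⟩
      0ℚ * 1/ q        ≡⟨ *-zeroˡ (1/ q) ⟩
      0ℚ               ∎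
    where
    open ≡-Reasoning
    instance
      q-nonZero : NonZero q
      q-nonZero = ≢-nonZero q≢0

  p≤q⇒0≤q-p : ∀ {p q} → p ≤ q → 0ℚ ≤ q - p
  p≤q⇒0≤q-p {p} {q} p≤q = subst (_≤ q - p) (+-inverseʳ p) (+-monoˡ-≤ (- p) p≤q)

  p<q⇒0<q-p : ∀ {p q} → p < q → 0ℚ < q - p
  p<q⇒0<q-p {p} {q} p<q = subst (_< q - p) (+-inverseʳ p) (+-monoˡ-< (- p) p<q)

  p≢q⇒q-p≢0 : ∀ {p q} → p ≢ q → q - p ≢ 0ℚ
  p≢q⇒q-p≢0 {p} {q} p≢q q-p≡0 = p≢q (begin
      p              ≡⟨ solve 2 (λ p q → p := q :- (q :- p)) refl p q ⟩
      q - (q - p)    ≡⟨ cong (λ r → q - r) q-p≡0 ⟩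
      q - 0ℚ         ≡⟨ +-identityʳ q ⟩
      q              ∎)
    where open ≡-Reasoning

  p<p+q : ∀ p {q} → 0ℚ < q → p < p + q
  p<p+q p 0<q = subst (_< p + _) (+-identityʳ p) (+-monoʳ-< p 0<q)

  p-q<p : ∀ p {q} → 0ℚ < q → p - q < p
  p-q<p p {q} 0<q = subst (p - q <_) (solve 2 (λ p q → p :- q :+ q := p) refl p q) (p<p+q (p - q) 0<q)

  p+q≤r⇒p≤r-q : ∀ p q r → p + q ≤ r → p ≤ r - q
  p+q≤r⇒p≤r-q p q r le = subst (_≤ r - q) (solve 2 (λ p q → p :+ q :- q := p) refl p q) (+-monoˡ-≤ (- q) le)

  p+q<r⇒p<r-q : ∀ p q r → p + q < r → p < r - q
  p+q<r⇒p<r-q p q r lt = subst (_< r - q) (solve 2 (λ p q → p :+ q :- q := p) refl p q) (+-monoˡ-< (- q) lt)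

  lerp : ℚ → ℚ → ℚ → ℚ
  lerp a b t = a + t * (b - a)

  lerp-within : ∀ {a b t} → 0ℚ ≤ t → t ≤ 1ℚ → a ≤ b → a ≤ lerp a b t × lerp a b t ≤ b
  lerp-within {a} {b} {t} 0≤t t≤1 a≤b = a≤lerp , lerp≤b
    where
    instance
      b-a-nonNegative : NonNegative (b - a)
      b-a-nonNegative = nonNegative (p≤q⇒0≤q-p a≤b)
    a≤lerp : a ≤ lerp a b t
    a≤lerp = subst (_≤ lerp a b t) (+-identityʳ a)
      (+-monoʳ-≤ a (subst (_≤ t * (b - a)) (*-zeroˡ (b - a)) (*-monoʳ-≤-nonNeg (b - a) 0≤t)))
    lerp≤b : lerp a b t ≤ b
    lerp≤b = subst (lerp a b t ≤_) (solve 2 (λ a b → a :+ (b :- a) := b) refl a b)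
      (+-monoʳ-≤ a (subst (t * (b - a) ≤_) (*-identityˡ (b - a)) (*-monoʳ-≤-nonNeg (b - a) t≤1)))

  lerp-reverse : ∀ a b t → lerp a b t ≡ lerp b a (1ℚ - t)
  lerp-reverse = solve 3 (λ a b t → a :+ t :* (b :- a) := b :+ (con 1ℚ :- t) :* (a :- b)) refl

  1-t≤1 : ∀ {t} → 0ℚ ≤ t → 1ℚ - t ≤ 1ℚ
  1-t≤1 {t} 0≤t = subst₂ _≤_ (+-identityʳ (1ℚ - t)) (solve 1 (λ t → con 1ℚ :- t :+ t := con 1ℚ) refl t)
    (+-monoʳ-≤ (1ℚ - t) 0≤t)

  lerp-within⁻ : ∀ {a b t} → 0ℚ ≤ t → t ≤ 1ℚ → b ≤ a → b ≤ lerp a b t × lerp a b t ≤ a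
  lerp-within⁻ {a} {b} {t} 0≤t t≤1 b≤a =
    subst (λ v → b ≤ v × v ≤ a) (sym (lerp-reverse a b t)) (lerp-within (p≤q⇒0≤q-p t≤1) (1-t≤1 0≤t) b≤a)

  lerp-const : ∀ a t → lerp a a t ≡ a
  lerp-const = solve 2 (λ a t → a :+ t :* (a :- a) := a) refl

  lerp-0 : ∀ a b → lerp a b 0ℚ ≡ a
  lerp-0 a b = trans (cong (a +_) (*-zeroˡ (b - a))) (+-identityʳ a)

  lerp-1 : ∀ a b → lerp a b 1ℚ ≡ b
  lerp-1 a b = trans (cong (a +_) (*-identityˡ (b - a))) (solve 2 (λ a b → a :+ (b :- a) := b) refl a b)

  lerp≡start⇒t≡0 : ∀ {a b t} → a ≢ b → lerp a b t ≡ a → t ≡ 0ℚ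
  lerp≡start⇒t≡0 {a} {b} {t} a≢b eq = p*q≡0⇒p≡0 t (b - a) (p≢q⇒q-p≢0 a≢b) (begin
      t * (b - a)       ≡⟨ solve 3 (λ a b t → t :* (b :- a) := (a :+ t :* (b :- a)) :- a) refl a b t ⟩
      lerp a b t - a    ≡⟨ cong (_- a) eq ⟩
      a - a             ≡⟨ +-inverseʳ a ⟩
      0ℚ                ∎)
    where open ≡-Reasoning

  lerp≡end⇒t≡1 : ∀ {a b t} → a ≢ b → lerp a b t ≡ b → t ≡ 1ℚ
  lerp≡end⇒t≡1 {a} {b} {t} a≢b eq = begin
      t                ≡⟨ solve 1 (λ t → t := con 1ℚ :- (con 1ℚ :- t)) refl t ⟩
      1ℚ - (1ℚ - t)    ≡⟨ cong (λ s → 1ℚ - s) (lerp≡start⇒t≡0 {b} {a} {1ℚ - t} (λ b≡a → a≢b (sym b≡a))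
                                                          (trans (sym (lerp-reverse a b t)) eq)) ⟩
      1ℚ - 0ℚ          ≡⟨⟩
      1ℚ               ∎
    where open ≡-Reasoning

  X Y : Point → ℚ
  X = proj₁
  Y = proj₂

  module _ (A B : Point) {p : Point} (p∈AB : OnSeg A B p) where
    private
      t : ℚ
      t = proj₁ p∈AB
      0≤t : 0ℚ ≤ t
      0≤t = proj₁ (proj₂ p∈AB)
      t≤1 : t ≤ 1ℚ
      t≤1 = proj₁ (proj₂ (proj₂ p∈AB))
      Xp≡ : X p ≡ lerp (X A) (X B) t
      Xp≡ = proj₁ (proj₂ (proj₂ (proj₂ p∈AB)))
      Yp≡ : Y p ≡ lerp (Y A) (Y B) t
      Yp≡ = proj₂ (proj₂ (proj₂ (proj₂ p∈AB)))

      within : ∀ {u a b} → u ≡ lerp a b t → a ≤ b → a ≤ u × u ≤ b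
      within refl = lerp-within 0≤t t≤1

      within⁻ : ∀ {u a b} → u ≡ lerp a b t → b ≤ a → b ≤ u × u ≤ a
      within⁻ refl = lerp-within⁻ 0≤t t≤1

      t≡0⇒start : t ≡ 0ℚ → p ≡ A
      t≡0⇒start refl = cong₂ _,_ (trans Xp≡ (lerp-0 (X A) (X B))) (trans Yp≡ (lerp-0 (Y A) (Y B)))

      t≡1⇒end : t ≡ 1ℚ → p ≡ B
      t≡1⇒end refl = cong₂ _,_ (trans Xp≡ (lerp-1 (X A) (X B))) (trans Yp≡ (lerp-1 (Y A) (Y B)))

    seg-X-within : X A ≤ X B → X A ≤ X p × X p ≤ X B
    seg-X-within = within Xp≡

    seg-Y-within : Y A ≤ Y B → Y A ≤ Y p × Y p ≤ Y B
    seg-Y-within = within Yp≡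

    seg-Y-within⁻ : Y B ≤ Y A → Y B ≤ Y p × Y p ≤ Y A
    seg-Y-within⁻ = within⁻ Yp≡

    seg-Y-const : Y A ≡ Y B → Y p ≡ Y A
    seg-Y-const refl = trans Yp≡ (lerp-const (Y A) t)

    seg-start-by-X : X A ≢ X B → X p ≡ X A → p ≡ A
    seg-start-by-X ne eq = t≡0⇒start (lerp≡start⇒t≡0 ne (trans (sym Xp≡) eq))

    seg-end-by-X : X A ≢ X B → X p ≡ X B → p ≡ B
    seg-end-by-X ne eq = t≡1⇒end (lerp≡end⇒t≡1 ne (trans (sym Xp≡) eq))

    seg-start-by-Y : Y A ≢ Y B → Y p ≡ Y A → p ≡ A
    seg-start-by-Y ne eq = t≡0⇒start (lerp≡start⇒t≡0 ne (trans (sym Yp≡) eq))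

    seg-end-by-Y : Y A ≢ Y B → Y p ≡ Y B → p ≡ B
    seg-end-by-Y ne eq = t≡1⇒end (lerp≡end⇒t≡1 ne (trans (sym Yp≡) eq))

  mirror : Point → Point
  mirror (x , y) = x , - y

  mirror-involutive : ∀ p → mirror (mirror p) ≡ p
  mirror-involutive (x , y) = cong (x ,_) (solve 1 (λ y → :- :- y := y) refl y)

  mirror-OnSeg : ∀ {A B} p → OnSeg (mirror A) (mirror B) p → OnSeg A B (mirror p)
  mirror-OnSeg {A} {B} p (t , 0≤t , t≤1 , Xp≡ , Yp≡) = t , 0≤t , t≤1 , Xp≡ , (begin
      - Y p                                     ≡⟨ cong -_ Yp≡ ⟩
      - lerp (- Y A) (- Y B) t    ≡⟨ solve 3 (λ a b t → :- (:- a :+ t :* (:- b :- :- a)) := a :+ t :* (b :- a))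
                                                refl (Y A) (Y B) t ⟩
      lerp (Y A) (Y B) t                        ∎)
    where open ≡-Reasoning

  mirror-OnPath : ∀ ps p → OnPath (map mirror ps) p → OnPath ps (mirror p)
  mirror-OnPath (A ∷ B ∷ ps) p (inj₁ p∈AB) = inj₁ (mirror-OnSeg {A} {B} p p∈AB)
  mirror-OnPath (A ∷ B ∷ ps) p (inj₂ p∈rest) = inj₂ (mirror-OnPath (B ∷ ps) p p∈rest)

  toℚ : ℕ → ℚ
  toℚ zero = 0ℚ
  toℚ (suc n) = toℚ n + 1ℚ

  toℚ-<-suc : ∀ n → toℚ n < toℚ (suc n)
  toℚ-<-suc n = p<p+q (toℚ n) (positive⁻¹ 1ℚ)

  toℚ-mono-≤ : ∀ {m n} → m ℕ.≤ n → toℚ m ≤ toℚ n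
  toℚ-mono-≤ {zero} {zero} ℕ.z≤n = ≤-refl
  toℚ-mono-≤ {zero} {suc n} ℕ.z≤n = ≤-trans (toℚ-mono-≤ {zero} {n} ℕ.z≤n) (<⇒≤ (toℚ-<-suc n))
  toℚ-mono-≤ {suc m} {suc n} (ℕ.s≤s m≤n) = +-monoˡ-≤ 1ℚ (toℚ-mono-≤ m≤n)

  toℚ-mono-< : ∀ {m n} → m ℕ.< n → toℚ m < toℚ n
  toℚ-mono-< {m} m<n = <-≤-trans (toℚ-<-suc m) (toℚ-mono-≤ m<n)

  toℚ-cancel-≤ : ∀ {m n} → toℚ m ≤ toℚ n → m ℕ.≤ n
  toℚ-cancel-≤ {m} {n} le with ℕₚ.≤-<-connex m n
  ... | inj₁ m≤n = m≤n
  ... | inj₂ n<m = ⊥-elim (<-irrefl refl (<-≤-trans (toℚ-mono-< n<m) le))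

  toℚ-injective : ∀ {m n} → toℚ m ≡ toℚ n → m ≡ n
  toℚ-injective eq = ℕₚ.≤-antisym (toℚ-cancel-≤ (≤-reflexive eq)) (toℚ-cancel-≤ (≤-reflexive (sym eq)))

  vertex : ℕ → Point
  vertex n = toℚ n , 0ℚ

  vertex-injective : ∀ {m n} → vertex m ≡ vertex n → m ≡ n
  vertex-injective eq = toℚ-injective (cong X eq)

  toℚ-between-suc : ∀ {a w} → toℚ a ≤ toℚ w → toℚ w ≤ toℚ (suc a) → w ≡ a ⊎ w ≡ suc a
  toℚ-between-suc {a} {w} a≤w w≤a+1 with ℕₚ.m≤n⇒m<n∨m≡n (toℚ-cancel-≤ {a} {w} a≤w)
  ... | inj₂ a≡w = inj₁ (sym a≡w)
  ... | inj₁ a<w = inj₂ (ℕₚ.≤-antisym (toℚ-cancel-≤ {w} {suc a} w≤a+1) a<w)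

  data Shape : Set where
    line upper lower : Shape

  -- Since the height of an upper arc equals its width, an arc strictly nested
  -- in [a , b] stays below the flat part of the arc over [a , b], which covers
  -- [a + 1 , b - 1].
  upperBends : ℕ → ℕ → List Point
  upperBends a b = (toℚ a + ½ , toℚ b - toℚ a) ∷ (toℚ b - ½ , toℚ b - toℚ a) ∷ []

  bends : Shape → ℕ → ℕ → List Point
  bends line  a b = []
  bends upper a b = upperBends a b
  bends lower a b = map mirror (upperBends a b)

  curve : Shape → ℕ → ℕ → List Point
  curve s a b = vertex a ∷ (bends s a b ++ (vertex b ∷ []))

  Fits : Shape → ℕ → ℕ → Set
  Fits line  a b = b ≡ suc a
  Fits upper a b = a ℕ.< b
  Fits lower a b = a ℕ.< b

  -- Definitionally curve lower a b = map mirror (curve upper a b), as - 0ℚ computes to 0ℚ.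
  lower⇒mirror-upper : ∀ a b p → OnPath (curve lower a b) p → OnPath (curve upper a b) (mirror p)
  lower⇒mirror-upper a b = mirror-OnPath (curve upper a b)

  module UpperArc {a b : ℕ} (a<b : a ℕ.< b) where

    private
      A B H : ℚ
      A = toℚ a
      B = toℚ b
      H = B - A

      P Q : Point
      P = A + ½ , H
      Q = B - ½ , H

      0<½ : 0ℚ < ½
      0<½ = positive⁻¹ ½

      0<H : 0ℚ < H
      0<H = p<q⇒0<q-p (toℚ-mono-< a<b)

      H≢0 : H ≢ 0ℚ
      H≢0 H≡0 = <-irrefl (sym H≡0) 0<H

      A<A+½ : A < A + ½
      A<A+½ = p<p+q A 0<½

      A+½<A+1 : A + ½ < A + 1ℚ
      A+½<A+1 = +-monoʳ-< A (p-q<p 1ℚ 0<½)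

      B-½<B : B - ½ < B
      B-½<B = p-q<p B 0<½

      A+½≤B-½ : A + ½ ≤ B - ½
      A+½≤B-½ = p+q≤r⇒p≤r-q (A + ½) ½ B (subst (_≤ B) (sym (+-assoc A ½ ½)) (toℚ-mono-≤ a<b))

      A<B-½ : A < B - ½
      A<B-½ = <-≤-trans A<A+½ A+½≤B-½

      A+½<B : A + ½ < B
      A+½<B = ≤-<-trans A+½≤B-½ B-½<B

    Y-range : ∀ p → OnPath (curve upper a b) p → 0ℚ ≤ Y p × Y p ≤ H
    Y-range p (inj₁ s) = seg-Y-within (vertex a) P s (<⇒≤ 0<H)
    Y-range p (inj₂ (inj₁ s)) = subst (0ℚ ≤_) (sym (seg-Y-const P Q s refl)) (<⇒≤ 0<H) , ≤-reflexive (seg-Y-const P Q s refl)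
    Y-range p (inj₂ (inj₂ (inj₁ s))) = seg-Y-within⁻ Q (vertex b) s (<⇒≤ 0<H)

    X-range : ∀ p → OnPath (curve upper a b) p → A ≤ X p × X p ≤ B
    X-range p (inj₁ s) = let (lo , hi) = seg-X-within (vertex a) P s (<⇒≤ A<A+½) in lo , ≤-trans hi (<⇒≤ A+½<B)
    X-range p (inj₂ (inj₁ s)) = let (lo , hi) = seg-X-within P Q s A+½≤B-½ in
      ≤-trans (<⇒≤ A<A+½) lo , ≤-trans hi (<⇒≤ B-½<B)
    X-range p (inj₂ (inj₂ (inj₁ s))) = let (lo , hi) = seg-X-within Q (vertex b) s (<⇒≤ B-½<B) in ≤-trans (<⇒≤ A<B-½) lo , hi

    Y≡0⇒end : ∀ p → OnPath (curve upper a b) p → Y p ≡ 0ℚ → p ≡ vertex a ⊎ p ≡ vertex b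
    Y≡0⇒end p (inj₁ s) Yp≡0 = inj₁ (seg-start-by-Y (vertex a) P s (λ 0≡H → H≢0 (sym 0≡H)) Yp≡0)
    Y≡0⇒end p (inj₂ (inj₁ s)) Yp≡0 = ⊥-elim (H≢0 (trans (sym (seg-Y-const P Q s refl)) Yp≡0))
    Y≡0⇒end p (inj₂ (inj₂ (inj₁ s))) Yp≡0 = inj₂ (seg-end-by-Y Q (vertex b) s H≢0 Yp≡0)

    X≤A⇒start : ∀ p → OnPath (curve upper a b) p → X p ≤ A → p ≡ vertex a
    X≤A⇒start p (inj₁ s) Xp≤A =
      seg-start-by-X (vertex a) P s (<⇒≢ A<A+½) (≤-antisym Xp≤A (proj₁ (seg-X-within (vertex a) P s (<⇒≤ A<A+½))))
    X≤A⇒start p (inj₂ (inj₁ s)) Xp≤A =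
      ⊥-elim (<-irrefl refl (<-≤-trans A<A+½ (≤-trans (proj₁ (seg-X-within P Q s A+½≤B-½)) Xp≤A)))
    X≤A⇒start p (inj₂ (inj₂ (inj₁ s))) Xp≤A =
      ⊥-elim (<-irrefl refl (<-≤-trans A<B-½ (≤-trans (proj₁ (seg-X-within Q (vertex b) s (<⇒≤ B-½<B))) Xp≤A)))

    B≤X⇒end : ∀ p → OnPath (curve upper a b) p → B ≤ X p → p ≡ vertex b
    B≤X⇒end p (inj₁ s) B≤Xp =
      ⊥-elim (<-irrefl refl (≤-<-trans B≤Xp (≤-<-trans (proj₂ (seg-X-within (vertex a) P s (<⇒≤ A<A+½))) A+½<B)))
    B≤X⇒end p (inj₂ (inj₁ s)) B≤Xp =
      ⊥-elim (<-irrefl refl (≤-<-trans B≤Xp (≤-<-trans (proj₂ (seg-X-within P Q s A+½≤B-½)) B-½<B)))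
    B≤X⇒end p (inj₂ (inj₂ (inj₁ s))) B≤Xp =
      seg-end-by-X Q (vertex b) s (<⇒≢ B-½<B) (≤-antisym (proj₂ (seg-X-within Q (vertex b) s (<⇒≤ B-½<B))) B≤Xp)

    flat : ∀ p → OnPath (curve upper a b) p → A + 1ℚ ≤ X p → X p + 1ℚ ≤ B → Y p ≡ H
    flat p (inj₁ s) A+1≤Xp _ =
      ⊥-elim (<-irrefl refl (<-≤-trans (≤-<-trans (proj₂ (seg-X-within (vertex a) P s (<⇒≤ A<A+½))) A+½<A+1) A+1≤Xp))
    flat p (inj₂ (inj₁ s)) _ _ = seg-Y-const P Q s refl
    flat p (inj₂ (inj₂ (inj₁ s))) _ Xp+1≤B =
      ⊥-elim (<-irrefl refl (≤-<-trans (proj₁ (seg-X-within Q (vertex b) s (<⇒≤ B-½<B))) Xp<B-½))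
      where
      Xp<B-½ : X p < B - ½
      Xp<B-½ = p+q<r⇒p<r-q (X p) ½ B (<-≤-trans (+-monoʳ-< (X p) (p-q<p 1ℚ 0<½)) Xp+1≤B)

  data Laminar (a b c e : ℕ) : Set where
    before   : b ℕ.≤ c → Laminar a b c e
    after    : e ℕ.≤ a → Laminar a b c e
    encloses : a ℕ.< c → e ℕ.< b → Laminar a b c e
    inside   : c ℕ.< a → b ℕ.< e → Laminar a b c e

  Laminar-sym : ∀ {a b c e} → Laminar a b c e → Laminar c e a b
  Laminar-sym (before b≤c)       = after b≤c
  Laminar-sym (after e≤a)        = before e≤a
  Laminar-sym (encloses a<c e<b) = inside a<c e<b
  Laminar-sym (inside c<a b<e)   = encloses c<a b<e

  EndOf : ℕ → ℕ → Point → Set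
  EndOf a b p = ∃[ w ] ((w ≡ a ⊎ w ≡ b) × p ≡ vertex w)

  CommonEnd : ℕ → ℕ → ℕ → ℕ → Point → Set
  CommonEnd a b c e p = ∃[ w ] ((w ≡ a ⊎ w ≡ b) × (w ≡ c ⊎ w ≡ e) × p ≡ vertex w)

  CommonEnd-sym : ∀ {a b c e p} → CommonEnd a b c e p → CommonEnd c e a b p
  CommonEnd-sym (w , w∈ab , w∈ce , p≡w) = w , w∈ce , w∈ab , p≡w

  EndOf-both : ∀ {a b c e p} → EndOf a b p → EndOf c e p → CommonEnd a b c e p
  EndOf-both (w , w∈ab , p≡w) (w′ , w′∈ce , p≡w′) =
    w , w∈ab , subst (λ v → v ≡ _ ⊎ v ≡ _) (vertex-injective (trans (sym p≡w′) p≡w)) w′∈ce , p≡w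

  EndOf-vertex : ∀ {a b w} → EndOf a b (vertex w) → w ≡ a ⊎ w ≡ b
  EndOf-vertex (v , v∈ab , w≡v) = subst (λ x → x ≡ _ ⊎ x ≡ _) (sym (vertex-injective w≡v)) v∈ab

  nested-height-< : ∀ u A B C → u + 1ℚ ≤ B → A + 1ℚ ≤ C → u - C < B - A
  nested-height-< u A B C u+1≤B A+1≤C = begin-strict
      u - C                ≤⟨ +-monoʳ-≤ u (neg-antimono-≤ A+1≤C) ⟩
      u - (A + 1ℚ)         ≡⟨ solve 2 (λ u A → u :- (A :+ con 1ℚ) := (u :- A) :+ (:- con 1ℚ)) refl u A ⟩
      (u - A) + (- 1ℚ)     <⟨ +-monoʳ-< (u - A) (<-trans (negative⁻¹ (- 1ℚ)) (positive⁻¹ 1ℚ)) ⟩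
      (u - A) + 1ℚ         ≡⟨ solve 2 (λ u A → (u :- A) :+ con 1ℚ := (u :+ con 1ℚ) :- A) refl u A ⟩
      (u + 1ℚ) - A         ≤⟨ +-monoˡ-≤ (- A) u+1≤B ⟩
      B - A                ∎
    where open ≤-Reasoning

  upper-upper : ∀ a b c e p → a ℕ.< b → c ℕ.< e → Laminar a b c e →
                OnPath (curve upper a b) p → OnPath (curve upper c e) p → CommonEnd a b c e p
  upper-upper a b c e p a<b c<e (before b≤c) p∈ab p∈ce = b , inj₂ refl , inj₁ (vertex-injective (trans (sym p≡b) p≡c)) , p≡b
    where
    p≡b : p ≡ vertex b
    p≡b = UpperArc.B≤X⇒end a<b p p∈ab (≤-trans (toℚ-mono-≤ b≤c) (proj₁ (UpperArc.X-range c<e p p∈ce)))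
    p≡c : p ≡ vertex c
    p≡c = UpperArc.X≤A⇒start c<e p p∈ce (≤-trans (proj₂ (UpperArc.X-range a<b p p∈ab)) (toℚ-mono-≤ b≤c))
  upper-upper a b c e p a<b c<e (after e≤a) p∈ab p∈ce =
    CommonEnd-sym (upper-upper c e a b p c<e a<b (before e≤a) p∈ce p∈ab)
  upper-upper a b c e p a<b c<e (encloses a<c e<b) p∈ab p∈ce =
    ⊥-elim (<-irrefl Yp≡outer (≤-<-trans (proj₂ (UpperArc.Y-range c<e p p∈ce)) inner<outer))
    where
    Xp∈ce = UpperArc.X-range c<e p p∈ce
    Yp≡outer : Y p ≡ toℚ b - toℚ a
    Yp≡outer = UpperArc.flat a<b p p∈ab (≤-trans (toℚ-mono-≤ a<c) (proj₁ Xp∈ce))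
      (≤-trans (+-monoˡ-≤ 1ℚ (proj₂ Xp∈ce)) (toℚ-mono-≤ e<b))
    inner<outer : toℚ e - toℚ c < toℚ b - toℚ a
    inner<outer = nested-height-< (toℚ e) (toℚ a) (toℚ b) (toℚ c) (toℚ-mono-≤ e<b) (toℚ-mono-≤ a<c)
  upper-upper a b c e p a<b c<e (inside c<a b<e) p∈ab p∈ce =
    CommonEnd-sym (upper-upper c e a b p c<e a<b (encloses c<a b<e) p∈ce p∈ab)

  upper-Y≡0 : ∀ a b p → a ℕ.< b → OnPath (curve upper a b) p → Y p ≡ 0ℚ → EndOf a b p
  upper-Y≡0 a b p a<b p∈ab Yp≡0 with UpperArc.Y≡0⇒end a<b p p∈ab Yp≡0
  ... | inj₁ p≡a = a , inj₁ refl , p≡a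
  ... | inj₂ p≡b = b , inj₂ refl , p≡b

  mirror-vertex : ∀ {p w} → mirror p ≡ vertex w → p ≡ vertex w
  mirror-vertex {p} mp≡w = trans (sym (mirror-involutive p)) (cong mirror mp≡w)

  lower-Y≡0 : ∀ a b p → a ℕ.< b → OnPath (curve lower a b) p → Y p ≡ 0ℚ → EndOf a b p
  lower-Y≡0 a b p a<b p∈ab Yp≡0 with upper-Y≡0 a b (mirror p) a<b (lower⇒mirror-upper a b p p∈ab) (cong -_ Yp≡0)
  ... | w , w∈ab , mp≡w = w , w∈ab , mirror-vertex {w = w} mp≡w

  upper-Y≥0 : ∀ a b p → a ℕ.< b → OnPath (curve upper a b) p → 0ℚ ≤ Y p
  upper-Y≥0 a b p a<b p∈ab = proj₁ (UpperArc.Y-range a<b p p∈ab)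

  lower-Y≤0 : ∀ a b p → a ℕ.< b → OnPath (curve lower a b) p → Y p ≤ 0ℚ
  lower-Y≤0 a b p a<b p∈ab = subst (_≤ 0ℚ) (solve 1 (λ y → :- :- y := y) refl (Y p))
    (neg-antimono-≤ (upper-Y≥0 a b (mirror p) a<b (lower⇒mirror-upper a b p p∈ab)))

  upper-lower : ∀ a b c e p → a ℕ.< b → c ℕ.< e →
                OnPath (curve upper a b) p → OnPath (curve lower c e) p → CommonEnd a b c e p
  upper-lower a b c e p a<b c<e p∈ab p∈ce = EndOf-both (upper-Y≡0 a b p a<b p∈ab Yp≡0) (lower-Y≡0 c e p c<e p∈ce Yp≡0)
    where
    Yp≡0 : Y p ≡ 0ℚ
    Yp≡0 = ≤-antisym (lower-Y≤0 c e p c<e p∈ce) (upper-Y≥0 a b p a<b p∈ab)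

  line-Y≡0 : ∀ a p → OnPath (curve line a (suc a)) p → Y p ≡ 0ℚ
  line-Y≡0 a p (inj₁ s) = seg-Y-const (vertex a) (vertex (suc a)) s refl

  line-X-range : ∀ a p → OnPath (curve line a (suc a)) p → toℚ a ≤ X p × X p ≤ toℚ (suc a)
  line-X-range a p (inj₁ s) = seg-X-within (vertex a) (vertex (suc a)) s (<⇒≤ (toℚ-<-suc a))

  line-vertex : ∀ a w → OnPath (curve line a (suc a)) (vertex w) → w ≡ a ⊎ w ≡ suc a
  line-vertex a w p∈a = toℚ-between-suc (proj₁ (line-X-range a (vertex w) p∈a)) (proj₂ (line-X-range a (vertex w) p∈a))

  line-EndOf : ∀ a c e p → OnPath (curve line a (suc a)) p → EndOf c e p → CommonEnd a (suc a) c e p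
  line-EndOf a c e p p∈a (w , w∈ce , refl) with line-vertex a w p∈a
  ... | inj₁ w≡a = w , inj₁ w≡a , w∈ce , refl
  ... | inj₂ w≡a+1 = w , inj₂ w≡a+1 , w∈ce , refl

  line-line : ∀ a c p → a ℕ.< c → OnPath (curve line a (suc a)) p → OnPath (curve line c (suc c)) p →
              CommonEnd a (suc a) c (suc c) p
  line-line a c p a<c p∈a p∈c = suc a , inj₂ refl , inj₁ (sym c≡a+1) , cong₂ _,_ (trans Xp≡c (cong toℚ c≡a+1)) (line-Y≡0 a p p∈a)
    where
    a+1≤c : toℚ (suc a) ≤ toℚ c
    a+1≤c = toℚ-mono-≤ a<c
    Xp≡c : X p ≡ toℚ c
    Xp≡c = ≤-antisym (≤-trans (proj₂ (line-X-range a p p∈a)) a+1≤c) (proj₁ (line-X-range c p p∈c))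
    c≡a+1 : c ≡ suc a
    c≡a+1 = toℚ-injective (≤-antisym (subst (_≤ toℚ (suc a)) Xp≡c (proj₂ (line-X-range a p p∈a))) a+1≤c)

  Separated : Shape → Shape → ℕ → ℕ → ℕ → ℕ → Set
  Separated upper upper a b c e = Laminar a b c e
  Separated lower lower a b c e = Laminar a b c e
  Separated _     _     _ _ _ _ = ⊤

  curves-meet-at-common-end : ∀ s s′ a b c e p → Fits s a b → Fits s′ c e → Separated s s′ a b c e →
    (a ≢ c ⊎ b ≢ e) → OnPath (curve s a b) p → OnPath (curve s′ c e) p → CommonEnd a b c e p
  curves-meet-at-common-end line line a .(suc a) c .(suc c) p refl refl _ a≢c⊎b≢e p∈ab p∈ce with ℕₚ.<-cmp a c
  ... | tri< a<c _ _ = line-line a c p a<c p∈ab p∈ce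
  ... | tri> _ _ c<a = CommonEnd-sym (line-line c a p c<a p∈ce p∈ab)
  ... | tri≈ _ refl _ with a≢c⊎b≢e
  ...   | inj₁ a≢a = ⊥-elim (a≢a refl)
  ...   | inj₂ b≢b = ⊥-elim (b≢b refl)
  curves-meet-at-common-end line upper a .(suc a) c e p refl c<e _ _ p∈ab p∈ce =
    line-EndOf a c e p p∈ab (upper-Y≡0 c e p c<e p∈ce (line-Y≡0 a p p∈ab))
  curves-meet-at-common-end line lower a .(suc a) c e p refl c<e _ _ p∈ab p∈ce =
    line-EndOf a c e p p∈ab (lower-Y≡0 c e p c<e p∈ce (line-Y≡0 a p p∈ab))
  curves-meet-at-common-end upper line a b c .(suc c) p a<b refl _ _ p∈ab p∈ce =
    CommonEnd-sym (line-EndOf c a b p p∈ce (upper-Y≡0 a b p a<b p∈ab (line-Y≡0 c p p∈ce)))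
  curves-meet-at-common-end lower line a b c .(suc c) p a<b refl _ _ p∈ab p∈ce =
    CommonEnd-sym (line-EndOf c a b p p∈ce (lower-Y≡0 a b p a<b p∈ab (line-Y≡0 c p p∈ce)))
  curves-meet-at-common-end upper upper a b c e p a<b c<e lam _ p∈ab p∈ce = upper-upper a b c e p a<b c<e lam p∈ab p∈ce
  curves-meet-at-common-end lower lower a b c e p a<b c<e lam _ p∈ab p∈ce
    with upper-upper a b c e (mirror p) a<b c<e lam (lower⇒mirror-upper a b p p∈ab) (lower⇒mirror-upper c e p p∈ce)
  ... | w , w∈ab , w∈ce , mp≡w = w , w∈ab , w∈ce , mirror-vertex {w = w} mp≡w
  curves-meet-at-common-end upper lower a b c e p a<b c<e _ _ p∈ab p∈ce = upper-lower a b c e p a<b c<e p∈ab p∈ce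
  curves-meet-at-common-end lower upper a b c e p a<b c<e _ _ p∈ab p∈ce = CommonEnd-sym (upper-lower c e a b p c<e a<b p∈ce p∈ab)

  curve-avoids-vertices : ∀ s a b w → Fits s a b → OnPath (curve s a b) (vertex w) → w ≡ a ⊎ w ≡ b
  curve-avoids-vertices line a .(suc a) w refl w∈ab = line-vertex a w w∈ab
  curve-avoids-vertices upper a b w a<b w∈ab = EndOf-vertex (upper-Y≡0 a b (vertex w) a<b w∈ab refl)
  curve-avoids-vertices lower a b w a<b w∈ab = EndOf-vertex (lower-Y≡0 a b (vertex w) a<b w∈ab refl)

  record ArcDiagram (G : Graph) : Set where
    open Graph G
    field
      shape     : Fin n → Fin n → Shape
      fits      : ∀ u v → IsEdge G u v → Fits (shape u v) (toℕ u) (toℕ v)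
      separated : ∀ u v u′ v′ → IsEdge G u v → IsEdge G u′ v′ → (u ≢ u′ ⊎ v ≢ v′) →
                  Separated (shape u v) (shape u′ v′) (toℕ u) (toℕ v) (toℕ u′) (toℕ v′)

  arcDiagram⇒planar : ∀ G → ArcDiagram G → Planar G
  arcDiagram⇒planar G D = record
    { pos                 = λ u → vertex (toℕ u)
    ; bends               = λ u v → bends (shape u v) (toℕ u) (toℕ v)
    ; pos-injective       = λ u v eq → toℕ-injective (vertex-injective eq)
    ; avoids-vertices     = avoids
    ; internally-disjoint = disjoint
    }
    where
    open Graph G
    open ArcDiagram D

    toℕ-≢ : ∀ {u v u′ v′ : Fin n} → (u ≢ u′ ⊎ v ≢ v′) → (toℕ u ≢ toℕ u′ ⊎ toℕ v ≢ toℕ v′)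
    toℕ-≢ = Sum.map (λ u≢u′ eq → u≢u′ (toℕ-injective eq)) (λ v≢v′ eq → v≢v′ (toℕ-injective eq))

    avoids : ∀ u v → IsEdge G u v → ∀ w → w ≢ u → w ≢ v → ¬ OnPath (curve (shape u v) (toℕ u) (toℕ v)) (vertex (toℕ w))
    avoids u v uv w w≢u w≢v w∈uv with curve-avoids-vertices (shape u v) _ _ (toℕ w) (fits u v uv) w∈uv
    ... | inj₁ w≡u = w≢u (toℕ-injective w≡u)
    ... | inj₂ w≡v = w≢v (toℕ-injective w≡v)

    disjoint : ∀ u v u′ v′ → IsEdge G u v → IsEdge G u′ v′ → (u ≢ u′ ⊎ v ≢ v′) → ∀ p →
      OnPath (curve (shape u v) (toℕ u) (toℕ v)) p → OnPath (curve (shape u′ v′) (toℕ u′) (toℕ v′)) p →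
      ∃[ w ] ((w ≡ u ⊎ w ≡ v) × (w ≡ u′ ⊎ w ≡ v′) × p ≡ vertex (toℕ w))
    disjoint u v u′ v′ uv u′v′ ne p p∈uv p∈u′v′
      with curves-meet-at-common-end (shape u v) (shape u′ v′) _ _ _ _ p (fits u v uv) (fits u′ v′ u′v′)
             (separated u v u′ v′ uv u′v′ ne) (toℕ-≢ ne) p∈uv p∈u′v′
    ... | w , inj₁ refl , w∈u′v′ , p≡w = u , inj₁ refl , Sum.map toℕ-injective toℕ-injective w∈u′v′ , p≡w
    ... | w , inj₂ refl , w∈u′v′ , p≡w = v , inj₂ refl , Sum.map toℕ-injective toℕ-injective w∈u′v′ , p≡w

open import Data.Nat as ℕ using (ℕ; zero; suc; z≤n; s≤s; _+_; _∸_; _^_; _≤_; _<_; ⌈_/2⌉)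
open import Data.Nat.Properties
open import Data.Nat.Solver using (module +-*-Solver)
open import Data.Fin using (Fin; toℕ; fromℕ<)
open import Data.Fin.Properties using (toℕ-fromℕ<; toℕ-injective; toℕ<n)
open import Data.Bool using (Bool; true; false; _∨_)
open import Data.Bool.Properties using (∨-comm)
open import Data.Product using (Σ; ∃-syntax; _×_; _,_; proj₁; proj₂; map₂)
open import Data.Product.Properties using (≡-dec)
open import Data.Sum using (_⊎_; inj₁; inj₂; swap)
open import Data.Empty using (⊥-elim)
open import Data.Unit using (tt)
open import Data.List using (List; []; _∷_; _++_; map; length)
open import Data.List.Properties using (length-++)
open import Data.List.Membership.Propositional using (_∈_)
open import Data.List.Membership.Propositional.Properties using (∈-map⁺; ∈-map⁻; ∈-++⁺ˡ; ∈-++⁺ʳ; ∈-++⁻)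
open import Data.List.Membership.DecPropositional (≡-dec ℕ._≟_ ℕ._≟_) using (_∈?_)
open import Data.List.Relation.Unary.Any using (here; there)
open import Function.Bundles using (mk⇔)
open import Relation.Nullary using (¬_; does; yes; no)
open import Relation.Binary.PropositionalEquality
open import Relation.Binary.Definitions using (tri<; tri≈; tri>)
open ArcDiagrams
  using (Laminar; before; after; encloses; inside; Laminar-sym; Shape; line; upper; lower; Fits; Separated;
         ArcDiagram; arcDiagram⇒planar)

Edge : Set
Edge = ℕ × ℕ

data EdgeWalk (E : List Edge) : ℕ → ℕ → ℕ → Set where
  []  : ∀ {u} → EdgeWalk E u u 0
  _∷_ : ∀ {u w v k} → (u , w) ∈ E ⊎ (w , u) ∈ E → EdgeWalk E w v k → EdgeWalk E u v (suc k)

_++ʷ_ : ∀ {E u w v m n} → EdgeWalk E u w m → EdgeWalk E w v n → EdgeWalk E u v (m + n)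
[] ++ʷ q = q
(e ∷ p) ++ʷ q = e ∷ (p ++ʷ q)

mapʷ : ∀ {E F} (f : ℕ → ℕ) → (∀ {a b} → (a , b) ∈ E → (f a , f b) ∈ F) →
       ∀ {u v n} → EdgeWalk E u v n → EdgeWalk F (f u) (f v) n
mapʷ f f-edge []             = []
mapʷ f f-edge (inj₁ e ∷ p) = inj₁ (f-edge e) ∷ mapʷ f f-edge p
mapʷ f f-edge (inj₂ e ∷ p) = inj₂ (f-edge e) ∷ mapʷ f f-edge p

edgeʷ : ∀ {E u v} → (u , v) ∈ E → EdgeWalk E u v 1
edgeʷ e = inj₁ e ∷ []

module EdgeListGraph (n : ℕ) (E : List Edge) (E-bounded : ∀ {a b} → (a , b) ∈ E → a < b × b < n) where

  adjacent : ℕ → ℕ → Bool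
  adjacent a b = does ((a , b) ∈? E) ∨ does ((b , a) ∈? E)

  adjacent-irrefl : ∀ a → adjacent a a ≡ false
  adjacent-irrefl a with (a , a) ∈? E
  ... | yes aa∈E = ⊥-elim (<-irrefl refl (proj₁ (E-bounded aa∈E)))
  ... | no _ = refl

  graph : Graph
  graph = record
    { n      = n
    ; adj    = λ u v → adjacent (toℕ u) (toℕ v)
    ; sym    = λ u v → ∨-comm (does ((toℕ u , toℕ v) ∈? E)) (does ((toℕ v , toℕ u) ∈? E))
    ; irrefl = λ u → adjacent-irrefl (toℕ u)
    }

  adjacent⇒edge : ∀ a b → adjacent a b ≡ true → (a , b) ∈ E ⊎ (b , a) ∈ E
  adjacent⇒edge a b adj with (a , b) ∈? E | (b , a) ∈? E
  ... | yes ab∈E | _        = inj₁ ab∈E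
  ... | no _     | yes ba∈E = inj₂ ba∈E

  edge⇒adjacent : ∀ a b → (a , b) ∈ E ⊎ (b , a) ∈ E → adjacent a b ≡ true
  edge⇒adjacent a b (inj₁ ab∈E) with (a , b) ∈? E
  ... | yes _ = refl
  ... | no ab∉E = ⊥-elim (ab∉E ab∈E)
  edge⇒adjacent a b (inj₂ ba∈E) =
    trans (∨-comm (does ((a , b) ∈? E)) (does ((b , a) ∈? E))) (edge⇒adjacent b a (inj₁ ba∈E))

  IsEdge⇒∈ : ∀ u v → IsEdge graph u v → (toℕ u , toℕ v) ∈ E
  IsEdge⇒∈ u v (u<v , adj) with adjacent⇒edge (toℕ u) (toℕ v) adj
  ... | inj₁ uv∈E = uv∈E
  ... | inj₂ vu∈E = ⊥-elim (<-asym u<v (proj₁ (E-bounded vu∈E)))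

  neighbour-bounded : ∀ {u w} → (u , w) ∈ E ⊎ (w , u) ∈ E → u < n → w < n
  neighbour-bounded (inj₁ uw∈E) _   = proj₂ (E-bounded uw∈E)
  neighbour-bounded (inj₂ wu∈E) u<n = <-trans (proj₁ (E-bounded wu∈E)) u<n

  toWalk : ∀ {u v k} → EdgeWalk E u v k → (u<n : u < n) (v<n : v < n) → Walk graph (fromℕ< u<n) (fromℕ< v<n) k
  toWalk [] u<n v<n = []
  toWalk {u} (_∷_ {w = w} e p) u<n v<n = adj ∷ toWalk p w<n v<n
    where
    w<n : w < n
    w<n = neighbour-bounded e u<n
    adj : Adj graph (fromℕ< u<n) (fromℕ< w<n)
    adj = subst₂ (λ x y → adjacent x y ≡ true) (sym (toℕ-fromℕ< u<n)) (sym (toℕ-fromℕ< w<n)) (edge⇒adjacent u w e)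

Label : Set
Label = ℕ × ℕ

Ascends : Label → Label → Set
Ascends (φ , μ) (φ′ , μ′) = φ′ ≡ suc φ × μ ≤ μ′

Step : Label → Label → Set
Step x y = Ascends x y ⊎ Ascends y x

module LevelledWalks (G : Graph) (label : Fin (Graph.n G) → Label)
                     (step : ∀ u v → Adj G u v → Step (label u) (label v)) where

  level rank : Fin (Graph.n G) → ℕ
  level u = proj₁ (label u)
  rank  u = proj₂ (label u)

  walk-level : ∀ {u v k} → Walk G u v k → level v ≤ level u + k × (level v ≡ level u + k → rank u ≤ rank v)
  walk-level {u} [] = ≤-reflexive (sym (+-identityʳ (level u))) , λ _ → ≤-refl
  walk-level {u} {v} {suc k} (_∷_ {w = w} uw p) with walk-level p | step u w uw
  ... | v≤w+k , tight | inj₁ (w≡u+1 , μu≤μw) = v≤u+k+1 , λ v≡u+k+1 → ≤-trans μu≤μw (tight (v≡w+k v≡u+k+1))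
    where
    w+k≡u+k+1 : level w + k ≡ level u + suc k
    w+k≡u+k+1 = trans (cong (_+ k) w≡u+1) (sym (+-suc (level u) k))
    v≤u+k+1 : level v ≤ level u + suc k
    v≤u+k+1 = ≤-trans v≤w+k (≤-reflexive w+k≡u+k+1)
    v≡w+k : level v ≡ level u + suc k → level v ≡ level w + k
    v≡w+k eq = trans eq (sym w+k≡u+k+1)
  ... | v≤w+k , _ | inj₂ (u≡w+1 , _) = <⇒≤ v<u+k+1 , λ v≡u+k+1 → ⊥-elim (<-irrefl v≡u+k+1 v<u+k+1)
    where
    v<u+k+1 : level v < level u + suc k
    v<u+k+1 = ≤-<-trans v≤w+k (begin-strict
      level w + k          <⟨ n<1+n _ ⟩
      suc (level w) + k    ≡⟨ cong (_+ k) (sym u≡w+1) ⟩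
      level u + k          <⟨ +-monoʳ-< (level u) (n<1+n k) ⟩
      level u + suc k      ∎)
      where open ≤-Reasoning

  short-walk-ascends : ∀ {d u v} → DistLE G d u v → level v ≡ level u + d → rank u ≤ rank v
  short-walk-ascends {d} {u} {v} (k , k≤d , p) v≡u+d = tight (trans v≡u+d (cong (level u +_) (sym k≡d)))
    where
    v≤u+k = proj₁ (walk-level p)
    tight = proj₂ (walk-level p)
    k≡d : k ≡ d
    k≡d = ≤-antisym k≤d (+-cancelˡ-≤ (level u) d k (subst (_≤ level u + k) v≡u+d v≤u+k))

module Construction (d : ℕ) where

  open +-*-Solver using (solve; _:+_; _:=_; con)

  -- The bridge of level k + 1 has suc (gap k) edges, that is d - 2k when 2k < d.
  gap : ℕ → ℕ
  gap k = d ∸ suc (k + k)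

  last size offset : ℕ → ℕ
  size k = suc (last k)
  offset k = suc (size k + gap k)
  last zero = 1
  last (suc k) = suc (offset k + last k)

  shiftEdge : ℕ → Edge → Edge
  shiftEdge s (a , b) = s + a , s + b

  copies : ℕ → List Edge → List Edge
  copies k F = map (shiftEdge 1) F ++ map (shiftEdge (offset k)) F

  path : ℕ → ℕ → List Edge
  path a zero    = []
  path a (suc m) = (a , suc a) ∷ path (suc a) m

  -- G_(k+1) has its root at 0, the first copy of G_k at 1 .. size k, the bridge from
  -- size k to offset k, the second copy from offset k on, and its sink at last (k + 1).
  lineEdges upperEdges lowerEdges edges : ℕ → List Edge
  lineEdges zero = []
  lineEdges (suc k) =
    (0 , 1) ∷ (path (size k) (suc (gap k)) ++ ((offset k + last k , last (suc k)) ∷ copies k (lineEdges k)))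
  upperEdges zero = []
  upperEdges (suc k) = (0 , offset k) ∷ copies k (upperEdges k)
  lowerEdges zero = []
  lowerEdges (suc k) = (size k , last (suc k)) ∷ copies k (lowerEdges k)
  edges k = lineEdges k ++ (upperEdges k ++ lowerEdges k)

  data InCopies (k : ℕ) (F : List Edge) : Edge → Set where
    first  : ∀ {x} → x ∈ F → InCopies k F (shiftEdge 1 x)
    second : ∀ {x} → x ∈ F → InCopies k F (shiftEdge (offset k) x)

  ∈-copies⁻ : ∀ k F {x} → x ∈ copies k F → InCopies k F x
  ∈-copies⁻ k F x∈ with ∈-++⁻ (map (shiftEdge 1) F) x∈
  ... | inj₁ x∈first with ∈-map⁻ (shiftEdge 1) x∈first
  ...   | y , y∈F , refl = first y∈F
  ∈-copies⁻ k F x∈ | inj₂ x∈second with ∈-map⁻ (shiftEdge (offset k)) x∈second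
  ...   | y , y∈F , refl = second y∈F

  ∈-path⁻ : ∀ a m {x} → x ∈ path a m → ∃[ j ] (j < m × x ≡ (a + j , suc (a + j)))
  ∈-path⁻ a (suc m) (here refl) = 0 , s≤s z≤n , cong₂ _,_ (sym (+-identityʳ a)) (cong suc (sym (+-identityʳ a)))
  ∈-path⁻ a (suc m) (there x∈) with ∈-path⁻ (suc a) m x∈
  ... | j , j<m , refl = suc j , s≤s j<m , cong₂ _,_ (sym (+-suc a j)) (cong suc (sym (+-suc a j)))

  InRange : ℕ → Edge → Set
  InRange k (a , b) = a < b × b ≤ last k

  size<offset : ∀ k → size k < offset k
  size<offset k = s≤s (m≤m+n (size k) (gap k))

  offset≤last : ∀ k → offset k ≤ last (suc k)
  offset≤last k = ≤-trans (m≤m+n (offset k) (last k)) (n≤1+n _)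

  InRange-copies : ∀ k F → (∀ {x} → x ∈ F → InRange k x) → ∀ {x} → x ∈ copies k F → InRange (suc k) x
  InRange-copies k F inRange x∈ with ∈-copies⁻ k F x∈
  ... | first {a , b} x∈F = let (a<b , b≤last) = inRange x∈F in
    s≤s a<b , ≤-trans (s≤s b≤last) (≤-trans (<⇒≤ (size<offset k)) (offset≤last k))
  ... | second {a , b} x∈F = let (a<b , b≤last) = inRange x∈F in
    +-monoʳ-< (offset k) a<b , ≤-trans (+-monoʳ-≤ (offset k) b≤last) (n≤1+n _)

  InRange-path : ∀ k {x} → x ∈ path (size k) (suc (gap k)) → InRange (suc k) x
  InRange-path k x∈ with ∈-path⁻ (size k) (suc (gap k)) x∈
  ... | j , s≤s j≤gap , refl = n<1+n _ , ≤-trans (s≤s (+-monoʳ-≤ (size k) j≤gap)) (offset≤last k)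

  InRange-line : ∀ k {x} → x ∈ lineEdges k → InRange k x
  InRange-line (suc k) (here refl) = s≤s z≤n , s≤s z≤n
  InRange-line (suc k) (there x∈) with ∈-++⁻ (path (size k) (suc (gap k))) x∈
  ... | inj₁ x∈path = InRange-path k x∈path
  ... | inj₂ (here refl) = n<1+n _ , ≤-refl
  ... | inj₂ (there x∈copies) = InRange-copies k (lineEdges k) (InRange-line k) x∈copies

  InRange-upper : ∀ k {x} → x ∈ upperEdges k → InRange k x
  InRange-upper (suc k) (here refl) = s≤s z≤n , offset≤last k
  InRange-upper (suc k) (there x∈) = InRange-copies k (upperEdges k) (InRange-upper k) x∈

  InRange-lower : ∀ k {x} → x ∈ lowerEdges k → InRange k x
  InRange-lower (suc k) (here refl) = s≤s (≤-trans (<⇒≤ (size<offset k)) (m≤m+n (offset k) (last k))) , ≤-refl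
  InRange-lower (suc k) (there x∈) = InRange-copies k (lowerEdges k) (InRange-lower k) x∈

  edges-bounded : ∀ k {a b} → (a , b) ∈ edges k → a < b × b < size k
  edges-bounded k ab∈ with ∈-++⁻ (lineEdges k) ab∈
  ... | inj₁ ab∈line = map₂ s≤s (InRange-line k ab∈line)
  ... | inj₂ ab∈arcs with ∈-++⁻ (upperEdges k) ab∈arcs
  ...   | inj₁ ab∈upper = map₂ s≤s (InRange-upper k ab∈upper)
  ...   | inj₂ ab∈lower = map₂ s≤s (InRange-lower k ab∈lower)

  lineEdge-unit : ∀ k {a b} → (a , b) ∈ lineEdges k → b ≡ suc a
  lineEdge-unit (suc k) (here refl) = refl
  lineEdge-unit (suc k) (there x∈) with ∈-++⁻ (path (size k) (suc (gap k))) x∈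
  ... | inj₁ x∈path with ∈-path⁻ (size k) (suc (gap k)) x∈path
  ...   | j , _ , refl = refl
  lineEdge-unit (suc k) (there x∈) | inj₂ (here refl) = refl
  lineEdge-unit (suc k) (there x∈) | inj₂ (there x∈copies) with ∈-copies⁻ k (lineEdges k) x∈copies
  ... | first x∈F = cong suc (lineEdge-unit k x∈F)
  ... | second {a , b} x∈F = trans (cong (offset k +_) (lineEdge-unit k x∈F)) (+-suc (offset k) a)

  LaminarEdges : Edge → Edge → Set
  LaminarEdges (a , b) (c , e) = Laminar a b c e

  EqualOrLaminar : Edge → Edge → Set
  EqualOrLaminar x y = x ≡ y ⊎ LaminarEdges x y

  Laminar-shift : ∀ s x y → LaminarEdges x y → LaminarEdges (shiftEdge s x) (shiftEdge s y)
  Laminar-shift s x y (before b≤c)       = before (+-monoʳ-≤ s b≤c)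
  Laminar-shift s x y (after e≤a)        = after (+-monoʳ-≤ s e≤a)
  Laminar-shift s x y (encloses a<c e<b) = encloses (+-monoʳ-< s a<c) (+-monoʳ-< s e<b)
  Laminar-shift s x y (inside c<a b<e)   = inside (+-monoʳ-< s c<a) (+-monoʳ-< s b<e)

  EqualOrLaminar-shift : ∀ s x y → EqualOrLaminar x y → EqualOrLaminar (shiftEdge s x) (shiftEdge s y)
  EqualOrLaminar-shift s x y (inj₁ refl) = inj₁ refl
  EqualOrLaminar-shift s x y (inj₂ lam)  = inj₂ (Laminar-shift s x y lam)

  first-before-second : ∀ k x y → InRange k x → LaminarEdges (shiftEdge 1 x) (shiftEdge (offset k) y)
  first-before-second k (a , b) (c , e) (_ , b≤last) =
    before (≤-trans (s≤s b≤last) (≤-trans (<⇒≤ (size<offset k)) (m≤m+n (offset k) c)))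

  Laminar-copies : ∀ k F new → (∀ {x} → x ∈ F → InRange k x) → (∀ {x y} → x ∈ F → y ∈ F → EqualOrLaminar x y) →
    (∀ x → InRange k x → LaminarEdges new (shiftEdge 1 x)) →
    (∀ x → InRange k x → LaminarEdges new (shiftEdge (offset k) x)) →
    ∀ {x y} → x ∈ new ∷ copies k F → y ∈ new ∷ copies k F → EqualOrLaminar x y
  Laminar-copies k F new inRange lam new-first new-second = go
    where
    new-copy : ∀ {x} → x ∈ copies k F → LaminarEdges new x
    new-copy x∈ with ∈-copies⁻ k F x∈
    ... | first {x} x∈F  = new-first x (inRange x∈F)
    ... | second {x} x∈F = new-second x (inRange x∈F)

    copy-copy : ∀ {x y} → x ∈ copies k F → y ∈ copies k F → EqualOrLaminar x y
    copy-copy x∈ y∈ with ∈-copies⁻ k F x∈ | ∈-copies⁻ k F y∈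
    ... | first {x} x∈F  | first {y} y∈F  = EqualOrLaminar-shift 1 x y (lam x∈F y∈F)
    ... | second {x} x∈F | second {y} y∈F = EqualOrLaminar-shift (offset k) x y (lam x∈F y∈F)
    ... | first {x} x∈F  | second {y} _   = inj₂ (first-before-second k x y (inRange x∈F))
    ... | second {x} _   | first {y} y∈F  = inj₂ (Laminar-sym (first-before-second k y x (inRange y∈F)))

    go : ∀ {x y} → x ∈ new ∷ copies k F → y ∈ new ∷ copies k F → EqualOrLaminar x y
    go (here refl) (here refl) = inj₁ refl
    go (here refl) (there y∈)  = inj₂ (new-copy y∈)
    go (there x∈)  (here refl) = inj₂ (Laminar-sym (new-copy x∈))
    go (there x∈)  (there y∈)  = copy-copy x∈ y∈

  Laminar-upper : ∀ k {x y} → x ∈ upperEdges k → y ∈ upperEdges k → EqualOrLaminar x y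
  Laminar-upper (suc k) = Laminar-copies k (upperEdges k) (0 , offset k) (InRange-upper k) (Laminar-upper k)
    (λ { (a , b) (_ , b≤last) → encloses (s≤s z≤n) (≤-trans (s≤s (s≤s b≤last)) (size<offset k)) })
    (λ { (a , b) _ → before (m≤m+n (offset k) a) })

  Laminar-lower : ∀ k {x y} → x ∈ lowerEdges k → y ∈ lowerEdges k → EqualOrLaminar x y
  Laminar-lower (suc k) = Laminar-copies k (lowerEdges k) (size k , last (suc k)) (InRange-lower k) (Laminar-lower k)
    (λ { (a , b) (_ , b≤last) → after (s≤s b≤last) })
    (λ { (a , b) (_ , b≤last) → encloses (≤-trans (size<offset k) (m≤m+n (offset k) a)) (s≤s (+-monoʳ-≤ (offset k) b≤last)) })

  rootRank : ℕ → ℕ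
  rootRank o = suc (suc (o + o))

  sinkRank : ℕ → ℕ → ℕ
  sinkRank k o = suc ((o + 2 ^ k) + (o + 2 ^ k))

  bridgeLabels : ℕ → ℕ → ℕ → List Label
  bridgeLabels φ μ zero    = []
  bridgeLabels φ μ (suc m) = (φ , μ) ∷ bridgeLabels (suc φ) μ m

  -- The (level , rank) of every position of G_k, whose leaf pairs are numbered
  -- from o on: a_j gets (d , 2j + 2) and b_j gets (0 , 2j + 3), so that
  -- rank b_i ≤ rank a_j exactly when i < j.
  labels : ℕ → ℕ → List Label
  labels zero o = (d , rootRank o) ∷ (0 , sinkRank 0 o) ∷ []
  labels (suc k) o = (d ∸ suc k , rootRank o) ∷
    (labels k o ++ (bridgeLabels (suc k) (rootRank (o + 2 ^ k)) (gap k) ++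
     (labels k (o + 2 ^ k) ++ ((suc k , sinkRank (suc k) o) ∷ []))))

  -- Out-of-range positions get the junk label (0 , 0).
  _!_ : List Label → ℕ → Label
  []       ! n     = 0 , 0
  (x ∷ xs) ! zero  = x
  (x ∷ xs) ! suc n = xs ! n

  !-++ˡ : ∀ xs ys {n} → n < length xs → (xs ++ ys) ! n ≡ xs ! n
  !-++ˡ (x ∷ xs) ys {zero}  _         = refl
  !-++ˡ (x ∷ xs) ys {suc n} (s≤s n<) = !-++ˡ xs ys n<

  !-++ʳ : ∀ xs ys n → (xs ++ ys) ! (length xs + n) ≡ ys ! n
  !-++ʳ []       ys n = refl
  !-++ʳ (x ∷ xs) ys n = !-++ʳ xs ys n

  length-bridgeLabels : ∀ φ μ m → length (bridgeLabels φ μ m) ≡ m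
  length-bridgeLabels φ μ zero    = refl
  length-bridgeLabels φ μ (suc m) = cong suc (length-bridgeLabels (suc φ) μ m)

  bridgeLabels-! : ∀ φ μ m j → j < m → bridgeLabels φ μ m ! j ≡ (φ + j , μ)
  bridgeLabels-! φ μ (suc m) zero    _         = cong (_, μ) (sym (+-identityʳ φ))
  bridgeLabels-! φ μ (suc m) (suc j) (s≤s j<m) = trans (bridgeLabels-! (suc φ) μ m j j<m) (cong (_, μ) (sym (+-suc φ j)))

  length-labels : ∀ k o → length (labels k o) ≡ size k
  length-labels zero o = refl
  length-labels (suc k) o = cong suc (begin
      length (First ++ (Bridge ++ (Second ++ Sink)))                        ≡⟨ length-++ First ⟩
      length First + length (Bridge ++ (Second ++ Sink))                   ≡⟨ cong (length First +_) (length-++ Bridge) ⟩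
      length First + (length Bridge + length (Second ++ Sink))            ≡⟨ cong (λ n → length First + (length Bridge + n)) (length-++ Second) ⟩
      length First + (length Bridge + (length Second + 1))
        ≡⟨ cong₂ (λ m n → m + (length Bridge + (n + 1))) (length-labels k o) (length-labels k (o + 2 ^ k)) ⟩
      size k + (length Bridge + (size k + 1))
        ≡⟨ cong (λ n → size k + (n + (size k + 1))) (length-bridgeLabels (suc k) _ (gap k)) ⟩
      size k + (gap k + (size k + 1))
        ≡⟨ solve 2 (λ m g → (con 1 :+ m) :+ (g :+ ((con 1 :+ m) :+ con 1))
                         := con 1 :+ (con 1 :+ (con 1 :+ m) :+ g) :+ m) refl (last k) (gap k) ⟩
      last (suc k)
        ∎)
    where
    open ≡-Reasoning
    First  = labels k o
    Bridge = bridgeLabels (suc k) (rootRank (o + 2 ^ k)) (gap k)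
    Second = labels k (o + 2 ^ k)
    Sink   = (suc k , sinkRank (suc k) o) ∷ []

  module LabelsOf (k o : ℕ) where
    private
      First Bridge Second Sink R : List Label
      First  = labels k o
      Bridge = bridgeLabels (suc k) (rootRank (o + 2 ^ k)) (gap k)
      Second = labels k (o + 2 ^ k)
      Sink   = (suc k , sinkRank (suc k) o) ∷ []
      R = First ++ (Bridge ++ (Second ++ Sink))

      length-First : length First ≡ size k
      length-First = length-labels k o
      length-Bridge : length Bridge ≡ gap k
      length-Bridge = length-bridgeLabels (suc k) (rootRank (o + 2 ^ k)) (gap k)
      length-Second : length Second ≡ size k
      length-Second = length-labels k (o + 2 ^ k)

    first-copy : ∀ i → i < size k → labels (suc k) o ! suc i ≡ First ! i
    first-copy i i< = !-++ˡ First (Bridge ++ (Second ++ Sink)) (subst (i <_) (sym length-First) i<)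

    bridge : ∀ j → j < gap k → labels (suc k) o ! suc (size k + j) ≡ (suc k + j , rootRank (o + 2 ^ k))
    bridge j j< = begin
        R ! (size k + j)                          ≡⟨ cong (λ n → R ! (n + j)) (sym length-First) ⟩
        R ! (length First + j)                    ≡⟨ !-++ʳ First (Bridge ++ (Second ++ Sink)) j ⟩
        (Bridge ++ (Second ++ Sink)) ! j          ≡⟨ !-++ˡ Bridge (Second ++ Sink) (subst (j <_) (sym length-Bridge) j<) ⟩
        Bridge ! j                                ≡⟨ bridgeLabels-! (suc k) (rootRank (o + 2 ^ k)) (gap k) j j< ⟩
        (suc k + j , rootRank (o + 2 ^ k))        ∎
      where open ≡-Reasoning

    second-copy : ∀ i → i < size k → labels (suc k) o ! (offset k + i) ≡ Second ! i
    second-copy i i< = begin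
        R ! ((size k + gap k) + i)                          ≡⟨ cong (R !_) (+-assoc (size k) (gap k) i) ⟩
        R ! (size k + (gap k + i))                          ≡⟨ cong₂ (λ m n → R ! (m + (n + i))) (sym length-First) (sym length-Bridge) ⟩
        R ! (length First + (length Bridge + i))            ≡⟨ !-++ʳ First (Bridge ++ (Second ++ Sink)) (length Bridge + i) ⟩
        (Bridge ++ (Second ++ Sink)) ! (length Bridge + i)  ≡⟨ !-++ʳ Bridge (Second ++ Sink) i ⟩
        (Second ++ Sink) ! i                                ≡⟨ !-++ˡ Second Sink (subst (i <_) (sym length-Second) i<) ⟩
        Second ! i                                          ∎
      where open ≡-Reasoning

    sink : labels (suc k) o ! last (suc k) ≡ (suc k , sinkRank (suc k) o)
    sink = begin
        R ! suc ((size k + gap k) + last k)                          ≡⟨ cong (R !_) (sym (+-suc (size k + gap k) (last k))) ⟩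
        R ! ((size k + gap k) + size k)                              ≡⟨ cong (R !_) (+-assoc (size k) (gap k) (size k)) ⟩
        R ! (size k + (gap k + size k))                              ≡⟨ cong (λ n → R ! (size k + (gap k + n))) (sym (+-identityʳ (size k))) ⟩
        R ! (size k + (gap k + (size k + 0)))                        ≡⟨ cong₂ (λ m n → R ! (m + (n + (size k + 0)))) (sym length-First) (sym length-Bridge) ⟩
        R ! (length First + (length Bridge + (size k + 0)))          ≡⟨ cong (λ n → R ! (length First + (length Bridge + (n + 0)))) (sym length-Second) ⟩
        R ! (length First + (length Bridge + (length Second + 0)))   ≡⟨ !-++ʳ First (Bridge ++ (Second ++ Sink)) _ ⟩
        (Bridge ++ (Second ++ Sink)) ! (length Bridge + (length Second + 0))  ≡⟨ !-++ʳ Bridge (Second ++ Sink) _ ⟩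
        (Second ++ Sink) ! (length Second + 0)                       ≡⟨ !-++ʳ Second Sink 0 ⟩
        (suc k , sinkRank (suc k) o)                                 ∎
      where open ≡-Reasoning

  root-label : ∀ k o → labels k o ! 0 ≡ (d ∸ k , rootRank o)
  root-label zero    o = refl
  root-label (suc k) o = refl

  sink-label : ∀ k o → labels k o ! last k ≡ (k , sinkRank k o)
  sink-label zero    o = refl
  sink-label (suc k) o = LabelsOf.sink k o

  -- Ensures 2j < d for every level j < k, so gap does not truncate below level k.
  Admissible : ℕ → Set
  Admissible k = k + k ≤ suc d

  Admissible-pred : ∀ {k} → Admissible (suc k) → Admissible k
  Admissible-pred {k} adm = ≤-trans (+-mono-≤ (n≤1+n k) (n≤1+n k)) adm

  Admissible⇒2k+1≤d : ∀ {k} → Admissible (suc k) → suc (k + k) ≤ d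
  Admissible⇒2k+1≤d {k} adm = subst (_≤ d) (+-suc k k) (≤-pred adm)

  Admissible⇒k<d : ∀ {k} → Admissible (suc k) → suc k ≤ d
  Admissible⇒k<d {k} adm = ≤-trans (m≤n+m (suc k) k) (≤-pred adm)

  d∸k≡1+d∸[1+k] : ∀ {k} → suc k ≤ d → d ∸ k ≡ suc (d ∸ suc k)
  d∸k≡1+d∸[1+k] = +-∸-assoc 1

  d∸k≡k+bridge : ∀ k → suc (k + k) ≤ d → d ∸ k ≡ k + suc (gap k)
  d∸k≡k+bridge k 2k+1≤d = begin
      d ∸ k                        ≡⟨ cong (_∸ k) (sym (m+[n∸m]≡n 2k+1≤d)) ⟩
      (suc (k + k) + gap k) ∸ k    ≡⟨ cong (_∸ k) (solve 2 (λ k g → con 1 :+ (k :+ k) :+ g := k :+ (con 1 :+ (k :+ g))) refl k (gap k)) ⟩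
      (k + suc (k + gap k)) ∸ k    ≡⟨ m+n∸m≡n k (suc (k + gap k)) ⟩
      suc (k + gap k)              ≡⟨ sym (+-suc k (gap k)) ⟩
      k + suc (gap k)              ∎
    where open ≡-Reasoning

  rootRank-mono : ∀ {o o′} → o ≤ o′ → rootRank o ≤ rootRank o′
  rootRank-mono o≤o′ = s≤s (s≤s (+-mono-≤ o≤o′ o≤o′))

  sinkRank≤rootRank : ∀ k o → sinkRank k o ≤ rootRank (o + 2 ^ k)
  sinkRank≤rootRank k o = n≤1+n _

  sinkRank-first : ∀ k o → sinkRank k o ≤ sinkRank (suc k) o
  sinkRank-first k o = s≤s (+-mono-≤ o+2^k≤o+2^[1+k] o+2^k≤o+2^[1+k])
    where
    o+2^k≤o+2^[1+k] : o + 2 ^ k ≤ o + 2 ^ suc k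
    o+2^k≤o+2^[1+k] = +-monoʳ-≤ o (m≤m+n (2 ^ k) (2 ^ k + 0))

  double-injective : ∀ {m n} → m + m ≡ n + n → m ≡ n
  double-injective {m} {n} eq with <-cmp m n
  ... | tri< m<n _ _ = ⊥-elim (<-irrefl eq (+-mono-< m<n m<n))
  ... | tri≈ _ m≡n _ = m≡n
  ... | tri> _ _ n<m = ⊥-elim (<-irrefl (sym eq) (+-mono-< n<m n<m))

  rootRank-injective : ∀ {i j} → rootRank i ≡ rootRank j → i ≡ j
  rootRank-injective eq = double-injective (suc-injective (suc-injective eq))

  leafSinkRank-injective : ∀ {i j} → sinkRank 0 i ≡ sinkRank 0 j → i ≡ j
  leafSinkRank-injective {i} {j} eq = +-cancelʳ-≡ 1 i j (double-injective (suc-injective eq))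

  leafSinkRank≤rootRank⇒< : ∀ i j → sinkRank 0 i ≤ rootRank j → i < j
  leafSinkRank≤rootRank⇒< i j le with i ℕ.<? j
  ... | yes i<j = i<j
  ... | no i≮j = ⊥-elim (<-irrefl refl (≤-trans 2i+2≤2j+1 (s≤s (+-mono-≤ j≤i j≤i))))
    where
    j≤i = ≮⇒≥ i≮j
    2i+2≤2j+1 : suc (suc (i + i)) ≤ suc (j + j)
    2i+2≤2j+1 = subst (_≤ suc (j + j)) (trans (cong₂ _+_ (+-comm i 1) (+-comm i 1)) (cong suc (+-suc i i))) (≤-pred le)

  sinkRank-second : ∀ k o → sinkRank k (o + 2 ^ k) ≡ sinkRank (suc k) o
  sinkRank-second k o = cong (λ n → suc (n + n)) (solve 2 (λ o p → o :+ p :+ p := o :+ (p :+ (p :+ con 0))) refl o (2 ^ k))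

  StepAlong : List Label → Edge → Set
  StepAlong L (a , b) = Step (L ! a) (L ! b)

  ascends-by : ∀ L a b {x y} → L ! a ≡ x → L ! b ≡ y → Ascends x y → StepAlong L (a , b)
  ascends-by L a b refl refl up = inj₁ up

  InRange⇒<size : ∀ k {a b} → InRange k (a , b) → a < size k × b < size k
  InRange⇒<size k (a<b , b≤last) = ≤-trans a<b (≤-trans b≤last (n≤1+n _)) , s≤s b≤last

  Step-copies : ∀ k o F → (∀ {x} → x ∈ F → InRange k x) → (∀ o′ {x} → x ∈ F → StepAlong (labels k o′) x) →
                ∀ {x} → x ∈ copies k F → StepAlong (labels (suc k) o) x
  Step-copies k o F inRange steps x∈ with ∈-copies⁻ k F x∈
  ... | first {a , b} x∈F = let (a< , b<) = InRange⇒<size k (inRange x∈F) in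
    subst₂ Step (sym (LabelsOf.first-copy k o a a<)) (sym (LabelsOf.first-copy k o b b<)) (steps o x∈F)
  ... | second {a , b} x∈F = let (a< , b<) = InRange⇒<size k (inRange x∈F) in
    subst₂ Step (sym (LabelsOf.second-copy k o a a<)) (sym (LabelsOf.second-copy k o b b<)) (steps (o + 2 ^ k) x∈F)

  module Bridge (k o : ℕ) (adm : Admissible (suc k)) where
    private
      L : List Label
      L = labels (suc k) o

    start : L ! (size k + 0) ≡ (k , sinkRank k o)
    start = trans (cong (L !_) (+-identityʳ (size k))) (trans (LabelsOf.first-copy k o (last k) ≤-refl) (sink-label k o))

    interior : ∀ m → m ≤ gap k → L ! (size k + suc m) ≡ (k + suc m , rootRank (o + 2 ^ k))
    interior m m≤gap with m≤n⇒m<n∨m≡n m≤gap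
    ... | inj₁ m<gap = trans (cong (L !_) (+-suc (size k) m)) (trans (LabelsOf.bridge k o m m<gap) (cong (_, rootRank (o + 2 ^ k)) (sym (+-suc k m))))
    ... | inj₂ refl = begin
        L ! (size k + suc (gap k))            ≡⟨ cong (L !_) (trans (+-suc (size k) (gap k)) (sym (+-identityʳ (offset k)))) ⟩
        L ! (offset k + 0)                    ≡⟨ LabelsOf.second-copy k o 0 (s≤s z≤n) ⟩
        labels k (o + 2 ^ k) ! 0              ≡⟨ root-label k (o + 2 ^ k) ⟩
        (d ∸ k , rootRank (o + 2 ^ k))        ≡⟨ cong (_, rootRank (o + 2 ^ k)) (d∸k≡k+bridge k (Admissible⇒2k+1≤d adm)) ⟩
        (k + suc (gap k) , rootRank (o + 2 ^ k)) ∎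
      where open ≡-Reasoning

    Step-bridge : ∀ {x} → x ∈ path (size k) (suc (gap k)) → StepAlong L x
    Step-bridge x∈ with ∈-path⁻ (size k) (suc (gap k)) x∈
    ... | zero , _ , refl =
      ascends-by L (size k + 0) (suc (size k + 0)) start (trans (cong (L !_) (sym (+-suc (size k) 0))) (interior 0 z≤n))
        (trans (+-suc k 0) (cong suc (+-identityʳ k)) , sinkRank≤rootRank k o)
    ... | suc j , s≤s j<gap , refl =
      ascends-by L (size k + suc j) (suc (size k + suc j)) (interior j (<⇒≤ j<gap))
        (trans (cong (L !_) (sym (+-suc (size k) (suc j)))) (interior (suc j) j<gap))
        (+-suc k (suc j) , ≤-refl)

  Step-line : ∀ k → Admissible k → ∀ o {x} → x ∈ lineEdges k → StepAlong (labels k o) x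
  Step-line (suc k) adm o (here refl) =
    ascends-by (labels (suc k) o) 0 1 refl (trans (LabelsOf.first-copy k o 0 (s≤s z≤n)) (root-label k o))
      (d∸k≡1+d∸[1+k] (Admissible⇒k<d adm) , ≤-refl)
  Step-line (suc k) adm o (there x∈) with ∈-++⁻ (path (size k) (suc (gap k))) x∈
  ... | inj₁ x∈bridge = Bridge.Step-bridge k o adm x∈bridge
  ... | inj₂ (here refl) =
    ascends-by (labels (suc k) o) (offset k + last k) (last (suc k))
      (trans (LabelsOf.second-copy k o (last k) ≤-refl) (sink-label k (o + 2 ^ k))) (LabelsOf.sink k o)
      (refl , ≤-reflexive (sinkRank-second k o))
  ... | inj₂ (there x∈copies) = Step-copies k o (lineEdges k) (InRange-line k) (λ o′ → Step-line k (Admissible-pred adm) o′) x∈copies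

  Step-upper : ∀ k → Admissible k → ∀ o {x} → x ∈ upperEdges k → StepAlong (labels k o) x
  Step-upper (suc k) adm o (here refl) =
    ascends-by (labels (suc k) o) 0 (offset k) refl
      (trans (cong (labels (suc k) o !_) (sym (+-identityʳ (offset k)))) (trans (LabelsOf.second-copy k o 0 (s≤s z≤n)) (root-label k (o + 2 ^ k))))
      (d∸k≡1+d∸[1+k] (Admissible⇒k<d adm) , rootRank-mono (m≤m+n o (2 ^ k)))
  Step-upper (suc k) adm o (there x∈) = Step-copies k o (upperEdges k) (InRange-upper k) (λ o′ → Step-upper k (Admissible-pred adm) o′) x∈

  Step-lower : ∀ k → Admissible k → ∀ o {x} → x ∈ lowerEdges k → StepAlong (labels k o) x
  Step-lower (suc k) adm o (here refl) =
    ascends-by (labels (suc k) o) (size k) (last (suc k)) (trans (LabelsOf.first-copy k o (last k) ≤-refl) (sink-label k o)) (LabelsOf.sink k o)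
      (refl , sinkRank-first k o)
  Step-lower (suc k) adm o (there x∈) = Step-copies k o (lowerEdges k) (InRange-lower k) (λ o′ → Step-lower k (Admissible-pred adm) o′) x∈

  Step-edges : ∀ k → Admissible k → ∀ o {x} → x ∈ edges k → StepAlong (labels k o) x
  Step-edges k adm o x∈ with ∈-++⁻ (lineEdges k) x∈
  ... | inj₁ x∈line = Step-line k adm o x∈line
  ... | inj₂ x∈arcs with ∈-++⁻ (upperEdges k) x∈arcs
  ...   | inj₁ x∈upper = Step-upper k adm o x∈upper
  ...   | inj₂ x∈lower = Step-lower k adm o x∈lower

  leafPos : ℕ → ℕ → ℕ
  leafPos zero    j = 0
  leafPos (suc k) j with j ℕ.<? 2 ^ k
  ... | yes _ = suc (leafPos k j)
  ... | no _  = offset k + leafPos k (j ∸ 2 ^ k)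

  j∸2^k<2^k : ∀ k j → ¬ j < 2 ^ k → j < 2 ^ suc k → j ∸ 2 ^ k < 2 ^ k
  j∸2^k<2^k k j j≮2^k j<2^[1+k] = +-cancelˡ-< (2 ^ k) (j ∸ 2 ^ k) (2 ^ k)
    (subst₂ _<_ (sym (m+[n∸m]≡n (≮⇒≥ j≮2^k))) (cong (2 ^ k +_) (+-identityʳ (2 ^ k))) j<2^[1+k])

  o+2^k+[j∸2^k] : ∀ k o j → ¬ j < 2 ^ k → (o + 2 ^ k) + (j ∸ 2 ^ k) ≡ o + j
  o+2^k+[j∸2^k] k o j j≮2^k = trans (+-assoc o (2 ^ k) (j ∸ 2 ^ k)) (cong (o +_) (m+[n∸m]≡n (≮⇒≥ j≮2^k)))

  leafPos<last : ∀ k j → j < 2 ^ k → leafPos k j < last k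
  leafPos<last zero zero _ = s≤s z≤n
  leafPos<last zero (suc j) (s≤s ())
  leafPos<last (suc k) j j< with j ℕ.<? 2 ^ k
  ... | yes j<2^k = ≤-trans (s≤s (leafPos<last k j j<2^k)) (≤-trans (<⇒≤ (size<offset k)) (offset≤last k))
  ... | no j≮2^k = ≤-trans (≤-reflexive (sym (+-suc (offset k) _)))
    (≤-trans (+-monoʳ-≤ (offset k) (leafPos<last k (j ∸ 2 ^ k) (j∸2^k<2^k k j j≮2^k j<))) (n≤1+n _))

  a-label : ∀ k o j → j < 2 ^ k → labels k o ! leafPos k j ≡ (d , rootRank (o + j))
  a-label zero o zero _ = cong (λ n → d , rootRank n) (sym (+-identityʳ o))
  a-label zero o (suc j) (s≤s ())
  a-label (suc k) o j j< with j ℕ.<? 2 ^ k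
  ... | yes j<2^k = trans (LabelsOf.first-copy k o (leafPos k j) (≤-trans (leafPos<last k j j<2^k) (n≤1+n _))) (a-label k o j j<2^k)
  ... | no j≮2^k = trans (LabelsOf.second-copy k o _ (≤-trans (leafPos<last k _ j′<) (n≤1+n _)))
    (trans (a-label k (o + 2 ^ k) _ j′<) (cong (λ n → d , rootRank n) (o+2^k+[j∸2^k] k o j j≮2^k)))
    where j′< = j∸2^k<2^k k j j≮2^k j<

  b-label : ∀ k o j → j < 2 ^ k → labels k o ! suc (leafPos k j) ≡ (0 , sinkRank 0 (o + j))
  b-label zero o zero _ = cong (λ n → 0 , sinkRank 0 n) (sym (+-identityʳ o))
  b-label zero o (suc j) (s≤s ())
  b-label (suc k) o j j< with j ℕ.<? 2 ^ k
  ... | yes j<2^k = trans (LabelsOf.first-copy k o (suc (leafPos k j)) (s≤s (leafPos<last k j j<2^k))) (b-label k o j j<2^k)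
  ... | no j≮2^k = trans (cong (labels (suc k) o !_) (sym (+-suc (offset k) _)))
    (trans (LabelsOf.second-copy k o _ (s≤s (leafPos<last k _ j′<)))
    (trans (b-label k (o + 2 ^ k) _ j′<) (cong (λ n → 0 , sinkRank 0 n) (o+2^k+[j∸2^k] k o j j≮2^k))))
    where j′< = j∸2^k<2^k k j j≮2^k j<

  line⊆edges : ∀ k {x} → x ∈ lineEdges k → x ∈ edges k
  line⊆edges k x∈ = ∈-++⁺ˡ x∈

  upper⊆edges : ∀ k {x} → x ∈ upperEdges k → x ∈ edges k
  upper⊆edges k x∈ = ∈-++⁺ʳ (lineEdges k) (∈-++⁺ˡ x∈)

  lower⊆edges : ∀ k {x} → x ∈ lowerEdges k → x ∈ edges k
  lower⊆edges k x∈ = ∈-++⁺ʳ (lineEdges k) (∈-++⁺ʳ (upperEdges k) x∈)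

  shift-edges : ∀ k s → (∀ {x} → x ∈ map (shiftEdge s) (lineEdges k) → x ∈ lineEdges (suc k)) →
    (∀ {x} → x ∈ map (shiftEdge s) (upperEdges k) → x ∈ upperEdges (suc k)) →
    (∀ {x} → x ∈ map (shiftEdge s) (lowerEdges k) → x ∈ lowerEdges (suc k)) →
    ∀ {a b} → (a , b) ∈ edges k → (s + a , s + b) ∈ edges (suc k)
  shift-edges k s into-line into-upper into-lower x∈ with ∈-++⁻ (lineEdges k) x∈
  ... | inj₁ x∈line = line⊆edges (suc k) (into-line (∈-map⁺ (shiftEdge s) x∈line))
  ... | inj₂ x∈arcs with ∈-++⁻ (upperEdges k) x∈arcs
  ...   | inj₁ x∈upper = upper⊆edges (suc k) (into-upper (∈-map⁺ (shiftEdge s) x∈upper))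
  ...   | inj₂ x∈lower = lower⊆edges (suc k) (into-lower (∈-map⁺ (shiftEdge s) x∈lower))

  first-copy-walk : ∀ k {u v n} → EdgeWalk (edges k) u v n → EdgeWalk (edges (suc k)) (suc u) (suc v) n
  first-copy-walk k = mapʷ suc (shift-edges k 1
    (λ x∈ → there (∈-++⁺ʳ (path (size k) (suc (gap k))) (there (∈-++⁺ˡ x∈))))
    (λ x∈ → there (∈-++⁺ˡ x∈)) (λ x∈ → there (∈-++⁺ˡ x∈)))

  second-copy-walk : ∀ k {u v n} → EdgeWalk (edges k) u v n → EdgeWalk (edges (suc k)) (offset k + u) (offset k + v) n
  second-copy-walk k = mapʷ (offset k +_) (shift-edges k (offset k)
    (λ x∈ → there (∈-++⁺ʳ (path (size k) (suc (gap k))) (there (∈-++⁺ʳ (map (shiftEdge 1) (lineEdges k)) x∈))))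
    (λ x∈ → there (∈-++⁺ʳ (map (shiftEdge 1) (upperEdges k)) x∈))
    (λ x∈ → there (∈-++⁺ʳ (map (shiftEdge 1) (lowerEdges k)) x∈)))

  path-walk : ∀ a m → EdgeWalk (path a m) a (a + m) m
  path-walk a zero = subst (λ b → EdgeWalk (path a zero) a b 0) (sym (+-identityʳ a)) []
  path-walk a (suc m) = inj₁ (here refl) ∷
    subst (λ b → EdgeWalk (path a (suc m)) (suc a) b m) (sym (+-suc a m)) (mapʷ (λ v → v) there (path-walk (suc a) m))

  bridge-walk : ∀ k → EdgeWalk (edges (suc k)) (size k) (offset k) (suc (gap k))
  bridge-walk k = subst (λ b → EdgeWalk (edges (suc k)) (size k) b (suc (gap k))) (+-suc (size k) (gap k))
    (mapʷ (λ v → v) (λ x∈ → line⊆edges (suc k) (there (∈-++⁺ˡ x∈))) (path-walk (size k) (suc (gap k))))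

  walk-to-sink : ∀ k j → j < 2 ^ k → EdgeWalk (edges k) (suc (leafPos k j)) (last k) k
  walk-to-sink zero zero _ = []
  walk-to-sink zero (suc j) (s≤s ())
  walk-to-sink (suc k) j j< with j ℕ.<? 2 ^ k
  ... | yes j<2^k = subst (EdgeWalk (edges (suc k)) (suc (suc (leafPos k j))) (last (suc k))) (+-comm k 1)
    (first-copy-walk k (walk-to-sink k j j<2^k) ++ʷ edgeʷ (lower⊆edges (suc k) (here refl)))
  ... | no j≮2^k = subst₂ (λ u n → EdgeWalk (edges (suc k)) u (last (suc k)) n) (+-suc (offset k) _) (+-comm k 1)
    (second-copy-walk k (walk-to-sink k (j ∸ 2 ^ k) (j∸2^k<2^k k j j≮2^k j<)) ++ʷ
     edgeʷ (line⊆edges (suc k) (there (∈-++⁺ʳ (path (size k) (suc (gap k))) (here refl)))))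

  walk-from-root : ∀ k j → j < 2 ^ k → EdgeWalk (edges k) 0 (leafPos k j) k
  walk-from-root zero zero _ = []
  walk-from-root zero (suc j) (s≤s ())
  walk-from-root (suc k) j j< with j ℕ.<? 2 ^ k
  ... | yes j<2^k = inj₁ (line⊆edges (suc k) (here refl)) ∷ first-copy-walk k (walk-from-root k j j<2^k)
  ... | no j≮2^k = inj₁ (upper⊆edges (suc k) (here refl)) ∷
    subst (λ u → EdgeWalk (edges (suc k)) u (offset k + leafPos k (j ∸ 2 ^ k)) k) (+-identityʳ (offset k))
      (second-copy-walk k (walk-from-root k (j ∸ 2 ^ k) (j∸2^k<2^k k j j≮2^k j<)))

  k+bridge+k≡d : ∀ k → suc (k + k) ≤ d → k + (suc (gap k) + k) ≡ d
  k+bridge+k≡d k 2k+1≤d = trans (solve 2 (λ k g → k :+ ((con 1 :+ g) :+ k) := (con 1 :+ (k :+ k)) :+ g) refl k (gap k)) (m+[n∸m]≡n 2k+1≤d)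

  short-walk : ∀ k → Admissible k → ∀ i j → i < j → j < 2 ^ k →
               ∃[ n ] (n ≤ d × EdgeWalk (edges k) (suc (leafPos k i)) (leafPos k j) n)
  short-walk zero adm i zero () _
  short-walk zero adm i (suc j) _ (s≤s ())
  short-walk (suc k) adm i j i<j j< with i ℕ.<? 2 ^ k | j ℕ.<? 2 ^ k
  ... | yes i<2^k | yes j<2^k = let (n , n≤d , w) = short-walk k (Admissible-pred adm) i j i<j j<2^k in n , n≤d , first-copy-walk k w
  ... | no i≮2^k | no j≮2^k =
    let (n , n≤d , w) = short-walk k (Admissible-pred adm) (i ∸ 2 ^ k) (j ∸ 2 ^ k) (∸-monoˡ-< i<j (≮⇒≥ i≮2^k)) (j∸2^k<2^k k j j≮2^k j<) in
    n , n≤d , subst (λ u → EdgeWalk (edges (suc k)) u (offset k + leafPos k (j ∸ 2 ^ k)) n) (+-suc (offset k) _) (second-copy-walk k w)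
  ... | no i≮2^k | yes j<2^k = ⊥-elim (i≮2^k (<-trans i<j j<2^k))
  ... | yes i<2^k | no j≮2^k = k + (suc (gap k) + k) , ≤-reflexive (k+bridge+k≡d k (Admissible⇒2k+1≤d adm)) ,
    first-copy-walk k (walk-to-sink k i i<2^k) ++ʷ (bridge-walk k ++ʷ
      subst (λ u → EdgeWalk (edges (suc k)) u (offset k + leafPos k (j ∸ 2 ^ k)) k) (+-identityʳ (offset k))
        (second-copy-walk k (walk-from-root k (j ∸ 2 ^ k) (j∸2^k<2^k k j j≮2^k j<))))

  module Drawing (k : ℕ) where

    shapeOf : ℕ → ℕ → Shape
    shapeOf a b with (a , b) ∈? upperEdges k | (a , b) ∈? lowerEdges k
    ... | yes _ | _     = upper
    ... | no _  | yes _ = lower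
    ... | no _  | no _  = line

    data DrawnAs (x : Edge) : Shape → Set where
      as-line  : x ∈ lineEdges k  → DrawnAs x line
      as-upper : x ∈ upperEdges k → DrawnAs x upper
      as-lower : x ∈ lowerEdges k → DrawnAs x lower

    drawnAs : ∀ a b → (a , b) ∈ edges k → DrawnAs (a , b) (shapeOf a b)
    drawnAs a b ab∈ with (a , b) ∈? upperEdges k | (a , b) ∈? lowerEdges k
    ... | yes ab∈upper | _ = as-upper ab∈upper
    ... | no _ | yes ab∈lower = as-lower ab∈lower
    ... | no ab∉upper | no ab∉lower with ∈-++⁻ (lineEdges k) ab∈
    ...   | inj₁ ab∈line = as-line ab∈line
    ...   | inj₂ ab∈arcs with ∈-++⁻ (upperEdges k) ab∈arcs
    ...     | inj₁ ab∈upper = ⊥-elim (ab∉upper ab∈upper)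
    ...     | inj₂ ab∈lower = ⊥-elim (ab∉lower ab∈lower)

    fits : ∀ {a b s} → DrawnAs (a , b) s → Fits s a b
    fits (as-line ab∈)  = lineEdge-unit k ab∈
    fits (as-upper ab∈) = proj₁ (InRange-upper k ab∈)
    fits (as-lower ab∈) = proj₁ (InRange-lower k ab∈)

    separated : ∀ {a b c e s s′} → DrawnAs (a , b) s → DrawnAs (c , e) s′ → (a , b) ≢ (c , e) → Separated s s′ a b c e
    separated (as-line _)  _            _ = tt
    separated (as-upper _) (as-line _)  _ = tt
    separated (as-lower _) (as-line _)  _ = tt
    separated (as-upper _) (as-lower _) _ = tt
    separated (as-lower _) (as-upper _) _ = tt
    separated (as-upper ab∈) (as-upper ce∈) ab≢ce with Laminar-upper k ab∈ ce∈
    ... | inj₁ ab≡ce = ⊥-elim (ab≢ce ab≡ce)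
    ... | inj₂ lam   = lam
    separated (as-lower ab∈) (as-lower ce∈) ab≢ce with Laminar-lower k ab∈ ce∈
    ... | inj₁ ab≡ce = ⊥-elim (ab≢ce ab≡ce)
    ... | inj₂ lam   = lam

module HalfGraphWitness (d : ℕ) (d≥1 : 1 ≤ d) where
  open Construction d

  h : ℕ
  h = ⌈ d /2⌉

  ⌈d/2⌉-admissible : Admissible h
  ⌈d/2⌉-admissible = ≤-trans (+-monoʳ-≤ h (⌊n/2⌋≤⌈n/2⌉ (suc d))) (≤-reflexive (⌊n/2⌋+⌈n/2⌉≡n (suc d)))

  open EdgeListGraph (size h) (edges h) (edges-bounded h) public

  label : Fin (size h) → Label
  label u = labels h 0 ! toℕ u

  step : ∀ u v → Adj graph u v → Step (label u) (label v)
  step u v uv with adjacent⇒edge (toℕ u) (toℕ v) uv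
  ... | inj₁ uv∈E = Step-edges h ⌈d/2⌉-admissible 0 uv∈E
  ... | inj₂ vu∈E = swap (Step-edges h ⌈d/2⌉-admissible 0 vu∈E)

  open LevelledWalks graph label step

  a<size : (j : Fin (2 ^ h)) → leafPos h (toℕ j) < size h
  a<size j = ≤-trans (leafPos<last h (toℕ j) (toℕ<n j)) (n≤1+n _)

  b<size : (j : Fin (2 ^ h)) → suc (leafPos h (toℕ j)) < size h
  b<size j = s≤s (leafPos<last h (toℕ j) (toℕ<n j))

  a b : Fin (2 ^ h) → Fin (size h)
  a j = fromℕ< (a<size j)
  b j = fromℕ< (b<size j)

  label-a : ∀ j → label (a j) ≡ (d , rootRank (toℕ j))
  label-a j = trans (cong (labels h 0 !_) (toℕ-fromℕ< (a<size j))) (a-label h 0 (toℕ j) (toℕ<n j))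

  label-b : ∀ j → label (b j) ≡ (0 , sinkRank 0 (toℕ j))
  label-b j = trans (cong (labels h 0 !_) (toℕ-fromℕ< (b<size j))) (b-label h 0 (toℕ j) (toℕ<n j))

  a-injective : ∀ i j → a i ≡ a j → i ≡ j
  a-injective i j ai≡aj = toℕ-injective (rootRank-injective
    (trans (sym (cong proj₂ (label-a i))) (trans (cong rank ai≡aj) (cong proj₂ (label-a j)))))

  b-injective : ∀ i j → b i ≡ b j → i ≡ j
  b-injective i j bi≡bj = toℕ-injective (leafSinkRank-injective
    (trans (sym (cong proj₂ (label-b i))) (trans (cong rank bi≡bj) (cong proj₂ (label-b j)))))

  a≢b : ∀ i j → a i ≢ b j
  a≢b i j ai≡bj = <-irrefl (sym d≡0) d≥1
    where
    d≡0 : d ≡ 0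
    d≡0 = trans (sym (cong proj₁ (label-a i))) (trans (cong level ai≡bj) (cong proj₁ (label-b j)))

  close⇒< : ∀ i j → DistLE graph d (b i) (a j) → toℕ i < toℕ j
  close⇒< i j bi~aj = leafSinkRank≤rootRank⇒< (toℕ i) (toℕ j)
    (subst₂ _≤_ (cong proj₂ (label-b i)) (cong proj₂ (label-a j))
      (short-walk-ascends bi~aj (trans (cong proj₁ (label-a j)) (cong (ℕ._+ d) (sym (cong proj₁ (label-b i)))))))

  <⇒close : ∀ i j → toℕ i < toℕ j → DistLE graph d (b i) (a j)
  <⇒close i j i<j with short-walk h ⌈d/2⌉-admissible (toℕ i) (toℕ j) i<j (toℕ<n j)
  ... | n , n≤d , w = n , n≤d , toWalk w (b<size i) (a<size j)

  halfGraph : HasDistHalfGraph graph d (2 ^ h)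
  halfGraph = a , b , a-injective , b-injective , a≢b , λ i j → mk⇔ (close⇒< i j) (<⇒close i j)

  arcDiagram : ArcDiagram graph
  arcDiagram = record
    { shape     = λ u v → Drawing.shapeOf h (toℕ u) (toℕ v)
    ; fits      = λ u v uv → Drawing.fits h (drawn u v uv)
    ; separated = λ u v u′ v′ uv u′v′ ne → Drawing.separated h (drawn u v uv) (drawn u′ v′ u′v′) (distinct ne)
    }
    where
    drawn : ∀ u v → IsEdge graph u v → Drawing.DrawnAs h (toℕ u , toℕ v) (Drawing.shapeOf h (toℕ u) (toℕ v))
    drawn u v uv = Drawing.drawnAs h (toℕ u) (toℕ v) (IsEdge⇒∈ u v uv)
    distinct : ∀ {u v u′ v′ : Fin (size h)} → (u ≢ u′ ⊎ v ≢ v′) → (toℕ u , toℕ v) ≢ (toℕ u′ , toℕ v′)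
    distinct (inj₁ u≢u′) eq = u≢u′ (toℕ-injective (cong proj₁ eq))
    distinct (inj₂ v≢v′) eq = v≢v′ (toℕ-injective (cong proj₂ eq))

corollary3p5 : (d : ℕ) → 1 ≤ d →
    Σ Graph λ G → Planar G × HasDistHalfGraph G d (2 ^ ⌈ d /2⌉)
corollary3p5 d d≥1 = graph , arcDiagram⇒planar graph arcDiagram , halfGraph
  where open HalfGraphWitness d d≥1
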